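{- Let $H_1,H_2$ be hyperplanes of $T$ and let $a,b\in V'$ with $ra\notin H_1$, $rb\notin H_2$, such that $C(H_1,a)$ and $C(H_2,b)$ are distinct classes of the partition $\Pi(2e,K)$. If $[a]$ and $[b]$ are non-adjacent in $\overline{X(2e,K)}$, then they have $\frac{(q^{2e-2}-1)q^{2e-3}}{q-1}$ common neighbours in $\overline{X(2e,K)}$; if they are adjacent in $\overline{X(2e,K)}$, then they have $\frac{(q^{2e-2}-1)q^{2e-3}}{q-1}-2$ common neighbours in $\overline{X(2e,K)}$.
   Context: Let $e\geq 2$ and let $K$ be a finite commutative ring with identity having precisely three ideals $\{0\}$, $J=\langle r\rangle$, $K$, with $K/J\cong\mathbb{F}_q$ ($q$ a prime power). Let $K^\times$ be the set of units, $V'$ the set of tuples in $K^{2e}$ with at least one entry in $K^\times$, for $a\in V'$ let $[a]=\{\lambda a:\lambda\in K^\times\}$, and $V=\{[a]:a\in V'\}$. For $a,b\in K^{2e}$ let $\langle a,b\rangle=\sum_{i=1}^e(a_ib_{e+i}-a_{e+i}b_i)$. The graph $X(2e,K)$ has vertex set $V$, $[a]\sim[b]$ iff $\langle a,b\rangle\in K\setminus\{0\}$; $\overline{X(2e,K)}$ is its complement. Let $T=J^{2e}$, a $2e$-dimensional vector space over $K/J$ with $(z+J)\cdot x=zx$; a hyperplane is a $(2e-1)$-dimensional subspace. For $u\in K^{2e}$, $ru\in T$ is the componentwise product. For a hyperplane $H$ and $u\in V'$ with $ru\notin H$, $C(H,u)=\{[u+h]:h\in H\}$; these sets form a partition of $V$,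 denoted $\Pi(2e,K)$. -}

module Defs where

open import Level using (Level; _⊔_)
open import Algebra.Bundles using (CommutativeRing)
open import Data.Nat as ℕ using (ℕ; zero; suc; _∸_; _^_)
open import Data.Fin using (Fin; _↑ˡ_; _↑ʳ_)
import Data.Fin as Fin
import Data.Unit
open import Data.Product using (Σ; ∃; ∃-syntax; _×_; _,_)
open import Data.Sum using (_⊎_; inj₁; inj₂)
open import Relation.Nullary using (¬_)
open import Relation.Binary.PropositionalEquality using (_≡_; _≢_)

-- Natural-number division, with the (irrelevant here) convention m / 0 = 0.
divℕ : ℕ → ℕ → ℕ
divℕ m zero    = 0
divℕ m (suc d) = m ℕ./ suc d

commonCount : ℕ → ℕ → ℕ
commonCount q e = divℕ ((q ^ (2 ℕ.* e ∸ 2) ∸ 1) ℕ.* q ^ (2 ℕ.* e ∸ 3)) (q ∸ 1)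

module Setup {c ℓ : Level} (K : CommutativeRing c ℓ) where
  open CommutativeRing K

  Car : Set c
  Car = Carrier

  sumF : ∀ {n} → (Fin n → Carrier) → Carrier
  sumF {zero}  f = 0#
  sumF {suc n} f = f Fin.zero + sumF (λ i → f (Fin.suc i))

  FiniteRing : Set (c ⊔ ℓ)
  FiniteRing = ∃[ n ] Σ (Fin n → Carrier) λ f →
                 (∀ x → ∃[ i ] f i ≈ x) × (∀ i j → f i ≈ f j → i ≡ j)

  IsUnit : Carrier → Set (c ⊔ ℓ)
  IsUnit x = ∃[ y ] x * y ≈ 1#

  record IsIdeal (I : Carrier → Set (c ⊔ ℓ)) : Set (c ⊔ ℓ) where
    field
      resp  : ∀ {x y} → x ≈ y → I x → I y
      zero∈ : I 0#
      +∈    : ∀ {x y} → I x → I y → I (x + y)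
      *∈    : ∀ z {x} → I x → I (z * x)

  SameSet : (Carrier → Set (c ⊔ ℓ)) → (Carrier → Set (c ⊔ ℓ)) → Set (c ⊔ ℓ)
  SameSet P Q = ∀ x → (P x → Q x) × (Q x → P x)

  ZeroIdeal : Carrier → Set (c ⊔ ℓ)
  ZeroIdeal x = Level.Lift c (x ≈ 0#)

  FullIdeal : Carrier → Set (c ⊔ ℓ)
  FullIdeal x = Level.Lift (c ⊔ ℓ) Data.Unit.⊤

  Principal : Carrier → Carrier → Set (c ⊔ ℓ)
  Principal r x = ∃[ y ] x ≈ y * r

  -- K has precisely the three ideals {0}, ⟨r⟩, K (pairwise distinct).
  ThreeIdeals : Carrier → Set (Level.suc (c ⊔ ℓ))
  ThreeIdeals r =
    ¬ (r ≈ 0#) × ¬ Principal r 1# ×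
    (∀ I → IsIdeal I →
       SameSet I ZeroIdeal ⊎ SameSet I (Principal r) ⊎ SameSet I FullIdeal)

  -- |K/J| = q : q representatives, pairwise incongruent mod J, covering K.
  ResidueSize : Carrier → ℕ → Set (c ⊔ ℓ)
  ResidueSize r q = Σ (Fin q → Carrier) λ rep →
    (∀ i j → Principal r (rep i - rep j) → i ≡ j) ×
    (∀ x → ∃[ i ] Principal r (x - rep i))

  -- vectors in K^(2e); coordinate i (1 ≤ i ≤ e) is inj₁ (i-1),
  -- coordinate e+i is inj₂ (i-1)
  Vect : ℕ → Set c
  Vect e = Fin e ⊎ Fin e → Carrier

  _≈ᵛ_ : ∀ {e} → Vect e → Vect e → Set ℓ
  a ≈ᵛ b = ∀ i → a i ≈ b i

  _+ᵛ_ : ∀ {e} → Vect e → Vect e → Vect e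
  (a +ᵛ b) i = a i + b i

  _·ᵛ_ : ∀ {e} → Carrier → Vect e → Vect e
  (z ·ᵛ a) i = z * a i

  0ᵛ : ∀ {e} → Vect e
  0ᵛ i = 0#

  form : ∀ {e} → Vect e → Vect e → Carrier
  form {e} a b = sumF {e} λ i →
    a (inj₁ i) * b (inj₂ i) - a (inj₂ i) * b (inj₁ i)

  InV' : ∀ {e} → Vect e → Set (c ⊔ ℓ)
  InV' a = ∃[ i ] IsUnit (a i)

  -- [a] = [b]  iff  b = λ a for a unit λ
  _∼_ : ∀ {e} → Vect e → Vect e → Set (c ⊔ ℓ)
  a ∼ b = ∃[ λ′ ] IsUnit λ′ × (b ≈ᵛ (λ′ ·ᵛ a))

  InT : Carrier → ∀ {e} → Vect e → Set (c ⊔ ℓ)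
  InT r a = ∀ i → Principal r (a i)

  linComb : ∀ {e m} → (Fin m → Carrier) → (Fin m → Vect e) → Vect e
  linComb z v i = sumF (λ k → z k * v k i)

  -- H is a K/J-subspace of T of dimension d (with (z+J)·x = z x)
  record IsSubspaceOfDim (r : Carrier) (e d : ℕ) (H : Vect e → Set (c ⊔ ℓ))
         : Set (c ⊔ ℓ) where
    field
      resp   : ∀ {x y : Vect e} → x ≈ᵛ y → H x → H y
      ⊆T     : ∀ {x : Vect e} → H x → InT r x
      zero∈  : H (0ᵛ {e})
      +∈     : ∀ {x y : Vect e} → H x → H y → H (x +ᵛ y)
      ·∈     : ∀ z {x : Vect e} → H x → H (z ·ᵛ x)
      basis  : Fin d → Vect e
      basis∈ : ∀ k → H (basis k)
      indep  : ∀ (z : Fin d → Carrier) → linComb z basis ≈ᵛ 0ᵛ → ∀ k → Principal r (z k)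
      span   : ∀ {x : Vect e} → H x → ∃[ z ] x ≈ᵛ linComb z basis

  Hyperplane : Carrier → (e : ℕ) → (Vect e → Set (c ⊔ ℓ)) → Set (c ⊔ ℓ)
  Hyperplane r e H = IsSubspaceOfDim r e (e ℕ.+ e ∸ 1) H

  -- [c] ∈ C(H,u) = {[u+h] : h ∈ H}
  InClass : ∀ {e} → (Vect e → Set (c ⊔ ℓ)) → Vect e → Vect e → Set (c ⊔ ℓ)
  InClass H u x = ∃[ h ] H h × (x ∼ (u +ᵛ h))

  DistinctClasses : ∀ {e} → (Vect e → Set (c ⊔ ℓ)) → Vect e →
                    (Vect e → Set (c ⊔ ℓ)) → Vect e → Set (c ⊔ ℓ)
  DistinctClasses H₁ a H₂ b =
    ¬ (∀ x → InV' x → (InClass H₁ a x → InClass H₂ b x) × (InClass H₂ b x → InClass H₁ a x))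

  -- adjacency in the complement of X(2e,K): distinct vertices with ⟨a,b⟩ = 0
  AdjComp : ∀ {e} → Vect e → Vect e → Set (c ⊔ ℓ)
  AdjComp a b = ¬ (a ∼ b) × Level.Lift c (form a b ≈ 0#)

  CommonNbr : ∀ {e} → Vect e → Vect e → Vect e → Set (c ⊔ ℓ)
  CommonNbr a b x = AdjComp x a × AdjComp x b

  -- the number of vertices [x] (x ∈ V') satisfying P is exactly N:
  -- N pairwise inequivalent representatives covering all such vertices
  CountVertices : ∀ {e} → (Vect e → Set (c ⊔ ℓ)) → ℕ → Set (c ⊔ ℓ)
  CountVertices {e} P N = Σ (Fin N → Vect e) λ w →
    (∀ i → InV' (w i) × P (w i)) ×
    (∀ i j → w i ∼ w j → i ≡ j) ×
    (∀ x → InV' x → P x → ∃[ i ] x ∼ w i)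

-- Up to units, the vertices x with ⟨x, a⟩ = ⟨x, b⟩ = 0 are the points of a projective space over K:
-- the two linear forms are independent modulo J, for otherwise b ≡ μ a (mod J) for a unit μ, and
-- since T = H ⊕ (K/J) r b for a hyperplane H ∌ r b this would make C(H₁, a) and C(H₂, b) equal.
-- Gaussian elimination with two unit pivots leaves the unimodular vectors of K^(2e-2) up to units,
-- and since |K| = q² these are ((q^(2e-2) - 1) q^(2e-3)) / (q - 1) many. They are the common
-- neighbours of [a] and [b], except for [a] and [b] themselves when these are adjacent.

module Submission where

open import Defs
open import Level using (Level; _⊔_; lift; lower)
open import Algebra.Bundles using (CommutativeRing)
open import Data.Nat using (ℕ; _≤_; _∸_)
open import Data.Product using (_×_)
open import Relation.Nullary using (¬_)

open import Data.Nat.Base as ℕ using (zero; suc; s≤s; z≤n)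
open import Data.Nat.Properties using (1+n≰n; ∸-+-assoc)
open import Data.Fin.Base using (Fin; zero; suc; punchIn; punchOut; splitAt; join)
open import Data.Fin.Properties
  using (+↔⊎; *↔×; any?; _≟_; injective⇒≤; punchOut-injective; punchIn-injective; punchInᵢ≢i; punchIn-punchOut;
         splitAt-join)
open import Data.Product.Base using (∃-syntax; _,_; proj₁; proj₂)
open import Data.Product.Relation.Binary.Pointwise.NonDependent using (_×ₛ_)
open import Data.Sum.Base as Sum using (_⊎_; inj₁; inj₂)
open import Data.Unit.Polymorphic using (⊤)
open import Data.Vec.Functional using (_∷_; head; tail; insertAt; removeAt)
open import Data.Vec.Functional.Properties using (insertAt-lookup; insertAt-punchIn; insertAt-removeAt)
open import Function.Bundles using (_↔_; Inverse)
open import Function.Indexed.Relation.Binary.Equality using (≡-setoid)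
open import Relation.Binary.Bundles using (Setoid)
import Relation.Binary.Indexed.Heterogeneous.Construct.Trivial as Trivial
open import Relation.Binary.PropositionalEquality as ≡ using (_≡_; _≢_)
open import Relation.Nullary using (Dec; yes; no; contradiction)
open import Relation.Nullary.Decidable using (map′)
open import Relation.Unary using (Pred; _≐_; _∪_; _⟨×⟩_; U)

-- Transversal S P (Fin N) says that P has exactly N elements up to ≈.
record Transversal {a ℓ p i} (S : Setoid a ℓ) (P : Pred (Setoid.Carrier S) p) (I : Set i)
       : Set (a ⊔ ℓ ⊔ p ⊔ i) where
  open Setoid S
  field
    point           : I → Carrier
    point∈P         : ∀ k → P (point k)
    point-injective : ∀ {k l} → point k ≈ point l → k ≡ l
    point-covers    : ∀ {x} → P x → ∃[ k ] x ≈ point k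

record ClassBijection {a b ℓ ℓ′ p p′} (S : Setoid a ℓ) (P : Pred (Setoid.Carrier S) p)
                      (T : Setoid b ℓ′) (Q : Pred (Setoid.Carrier T) p′)
       : Set (a ⊔ b ⊔ ℓ ⊔ ℓ′ ⊔ p ⊔ p′) where
  module S = Setoid S
  module T = Setoid T
  field
    map           : S.Carrier → T.Carrier
    map∈Q         : ∀ {x} → P x → Q (map x)
    map-cong      : ∀ {x y} → P x → P y → x S.≈ y → map x T.≈ map y
    map-injective : ∀ {x y} → P x → P y → map x T.≈ map y → x S.≈ y
    map-onto      : ∀ {z} → Q z → ∃[ x ] P x × z T.≈ map x

module _ {a b ℓ ℓ′ p p′ i} {S : Setoid a ℓ} {T : Setoid b ℓ′}
         {P : Pred (Setoid.Carrier S) p} {Q : Pred (Setoid.Carrier T) p′} {I : Set i} where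

  transport : ClassBijection S P T Q → Transversal S P I → Transversal T Q I
  transport f E = record
    { point           = λ k → map (point k)
    ; point∈P         = λ k → map∈Q (point∈P k)
    ; point-injective = λ eq → point-injective (map-injective (point∈P _) (point∈P _) eq)
    ; point-covers    = covers
    }
    where
    open ClassBijection f
    open Transversal E
    covers : ∀ {z} → Q z → ∃[ k ] z T.≈ map (point k)
    covers qz with x , px , z≈fx ← map-onto qz with k , x≈pk ← point-covers px =
      k , T.trans z≈fx (map-cong px (point∈P k) x≈pk)

module _ {a ℓ p} {S : Setoid a ℓ} {P : Pred (Setoid.Carrier S) p} where
  open Setoid S

  resp-≐ : ∀ {p′ i} {Q : Pred Carrier p′} {I : Set i} → P ≐ Q → Transversal S P I → Transversal S Q I
  resp-≐ (P⊆Q , Q⊆P) = transport record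
    { map           = λ x → x
    ; map∈Q         = P⊆Q
    ; map-cong      = λ _ _ eq → eq
    ; map-injective = λ _ _ eq → eq
    ; map-onto      = λ {z} qz → z , Q⊆P qz , refl
    }

  reindex : ∀ {i j} {I : Set i} {J : Set j} → J ↔ I → Transversal S P I → Transversal S P J
  reindex J↔I E = record
    { point           = λ k → point (to k)
    ; point∈P         = λ k → point∈P (to k)
    ; point-injective = λ eq → to-injective (point-injective eq)
    ; point-covers    = λ px → let k , x≈pk = point-covers px in
        from k , trans x≈pk (reflexive (≡.cong point (≡.sym (strictlyInverseˡ k))))
    }
    where
    open Transversal E
    open Inverse J↔I
    to-injective : ∀ {k l} → to k ≡ to l → k ≡ l
    to-injective {k} {l} eq = ≡.trans (≡.sym (strictlyInverseʳ k)) (≡.trans (≡.cong from eq) (strictlyInverseʳ l))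

  ⊎-transversal : ∀ {p′ i j} {Q : Pred Carrier p′} {I : Set i} {J : Set j} →
                  (∀ {x y} → P x → Q y → ¬ x ≈ y) →
                  Transversal S P I → Transversal S Q J → Transversal S (P ∪ Q) (I ⊎ J)
  ⊎-transversal {Q = Q} {I} {J} disjoint E F = record
    { point           = point
    ; point∈P         = point∈P
    ; point-injective = injective _ _
    ; point-covers    = covers
    }
    where
    module E = Transversal E
    module F = Transversal F
    point : I ⊎ J → Carrier
    point (inj₁ k) = E.point k
    point (inj₂ l) = F.point l
    point∈P : ∀ k → (P ∪ Q) (point k)
    point∈P (inj₁ k) = inj₁ (E.point∈P k)
    point∈P (inj₂ l) = inj₂ (F.point∈P l)
    injective : ∀ k l → point k ≈ point l → k ≡ l
    injective (inj₁ k) (inj₁ k′) eq = ≡.cong inj₁ (E.point-injective eq)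
    injective (inj₁ k) (inj₂ l)  eq = contradiction eq (disjoint (E.point∈P k) (F.point∈P l))
    injective (inj₂ l) (inj₁ k)  eq = contradiction (sym eq) (disjoint (E.point∈P k) (F.point∈P l))
    injective (inj₂ l) (inj₂ l′) eq = ≡.cong inj₂ (F.point-injective eq)
    covers : ∀ {x} → (P ∪ Q) x → ∃[ k ] x ≈ point k
    covers (inj₁ px) = let k , eq = E.point-covers px in inj₁ k , eq
    covers (inj₂ qx) = let l , eq = F.point-covers qx in inj₂ l , eq

  ×-transversal : ∀ {b ℓ′ p′ i j} {T : Setoid b ℓ′} {Q : Pred (Setoid.Carrier T) p′} {I : Set i} {J : Set j} →
                  Transversal S P I → Transversal T Q J → Transversal (S ×ₛ T) (P ⟨×⟩ Q) (I × J)
  ×-transversal E F = record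
    { point           = λ (k , l) → E.point k , F.point l
    ; point∈P         = λ (k , l) → E.point∈P k , F.point∈P l
    ; point-injective = λ (eq , eq′) → ≡.cong₂ _,_ (E.point-injective eq) (F.point-injective eq′)
    ; point-covers    = λ (px , qy) → let k , eq = E.point-covers px ; l , eq′ = F.point-covers qy in
        (k , l) , eq , eq′
    }
    where
    module E = Transversal E
    module F = Transversal F

  remove : ∀ {N x} → Transversal S P (Fin N) → P x → Transversal S (λ y → P y × ¬ y ≈ x) (Fin (N ∸ 1))
  remove {zero} E px = contradiction (proj₁ (Transversal.point-covers E px)) λ ()
  remove {suc N} {x} E px = record
    { point           = λ l → point (punchIn k l)
    ; point∈P         = λ l → point∈P _ , λ eq → punchInᵢ≢i k l (point-injective (trans eq x≈pk))
    ; point-injective = λ eq → punchIn-injective k _ _ (point-injective eq)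
    ; point-covers    = covers
    }
    where
    open Transversal E
    k : Fin (suc N)
    k = proj₁ (point-covers px)
    x≈pk : x ≈ point k
    x≈pk = proj₂ (point-covers px)
    covers : ∀ {y} → P y × ¬ y ≈ x → ∃[ l ] y ≈ point (punchIn k l)
    covers (py , y≉x) with j , y≈pj ← point-covers py =
      punchOut k≢j , trans y≈pj (reflexive (≡.cong point (≡.sym (punchIn-punchOut k≢j))))
      where
      k≢j : k ≢ j
      k≢j ≡.refl = y≉x (trans y≈pj (sym x≈pk))

pointwise : ∀ {a ℓ} → Set → Setoid a ℓ → Setoid a ℓ
pointwise I S = ≡-setoid I (Trivial.indexedSetoid S)

module _ {a ℓ p} {S : Setoid a ℓ} {P : Pred (Setoid.Carrier S) p} where
  open Setoid S

  power : ∀ {N} → Transversal S P (Fin N) → ∀ m →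
          Transversal (pointwise (Fin m) S) (λ v → ∀ k → P (v k)) (Fin (N ℕ.^ m))
  power E zero = record
    { point           = λ _ ()
    ; point∈P         = λ _ ()
    ; point-injective = λ { {zero} {zero} _ → ≡.refl }
    ; point-covers    = λ _ → zero , λ ()
    }
  power E (suc m) = reindex *↔× (transport cons (×-transversal E (power E m)))
    where
    cons : ClassBijection (S ×ₛ pointwise (Fin m) S) (P ⟨×⟩ λ v → ∀ k → P (v k))
                          (pointwise (Fin (suc m)) S) (λ v → ∀ k → P (v k))
    cons = record
      { map           = λ (x , v) → x ∷ v
      ; map∈Q         = λ { (px , pv) zero → px ; (px , pv) (suc k) → pv k }
      ; map-cong      = λ { _ _ (eq , eq′) zero → eq ; _ _ (eq , eq′) (suc k) → eq′ k }
      ; map-injective = λ _ _ eq → eq zero , λ k → eq (suc k)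
      ; map-onto      = λ {v} pv → (v zero , λ k → v (suc k)) , (pv zero , λ k → pv (suc k)) ,
                                   λ { zero → refl ; (suc k) → refl }
      }

  remove₂ : ∀ {N x y} → Transversal S P (Fin N) → P x → P y → ¬ y ≈ x →
            Transversal S (λ z → (P z × ¬ z ≈ x) × ¬ z ≈ y) (Fin (N ∸ 2))
  remove₂ {N} {x} {y} E px py y≉x =
    ≡.subst (λ n → Transversal S (λ z → (P z × ¬ z ≈ x) × ¬ z ≈ y) (Fin n)) (∸-+-assoc N 1 1)
            (remove {x = y} (remove {x = x} E px) (py , y≉x))

  power-along : ∀ {N n} {I : Set} → Fin n ↔ I → Transversal S P (Fin N) →
                Transversal (pointwise I S) (λ v → ∀ i → P (v i)) (Fin (N ℕ.^ n))
  power-along {n = n} {I} Fin↔I E = transport along (power E n)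
    where
    open Inverse Fin↔I
    along : ClassBijection (pointwise (Fin n) S) (λ v → ∀ k → P (v k)) (pointwise I S) (λ v → ∀ i → P (v i))
    along = record
      { map           = λ v i → v (from i)
      ; map∈Q         = λ pv i → pv (from i)
      ; map-cong      = λ _ _ eq i → eq (from i)
      ; map-injective = λ {v} {w} _ _ eq k →
          ≡.subst (λ l → v l ≈ w l) (strictlyInverseʳ k) (eq (to k))
      ; map-onto      = λ {v} pv → (λ k → v (to k)) , (λ k → pv (to k)) ,
          λ i → reflexive (≡.cong v (≡.sym (strictlyInverseˡ i)))
      }

injective⇒surjective : ∀ {n} (f : Fin n → Fin n) → (∀ {i j} → f i ≡ f j → i ≡ j) → ∀ y → ∃[ x ] f x ≡ y
injective⇒surjective {suc n} f f-injective y with any? (λ x → f x ≟ y)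
... | yes hit = hit
... | no miss = contradiction (injective⇒≤ punched-injective) 1+n≰n
  where
  y≢f : ∀ x → y ≢ f x
  y≢f x eq = miss (x , ≡.sym eq)
  punched-injective : ∀ {i j} → punchOut (y≢f i) ≡ punchOut (y≢f j) → i ≡ j
  punched-injective eq = f-injective (punchOut-injective (y≢f _) (y≢f _) eq)

injective⇒onto : ∀ {a b ℓ ℓ′ p p′ N} {S : Setoid a ℓ} {T : Setoid b ℓ′}
                 {P : Pred (Setoid.Carrier S) p} {Q : Pred (Setoid.Carrier T) p′} →
                 Transversal S P (Fin N) → Transversal T Q (Fin N) →
                 (f : Setoid.Carrier S → Setoid.Carrier T) → (∀ {x} → P x → Q (f x)) →
                 (∀ {x y} → P x → P y → Setoid._≈_ T (f x) (f y) → Setoid._≈_ S x y) →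
                 ∀ {z} → Q z → ∃[ x ] P x × Setoid._≈_ T z (f x)
injective⇒onto {T = T} E F f f∈Q f-injective {z} qz = E.point k , E.point∈P k , z≈fk
  where
  open Setoid T
  module E = Transversal E
  module F = Transversal F
  φ : _ → _
  φ k = proj₁ (F.point-covers (f∈Q (E.point∈P k)))
  class : ∀ k → f (E.point k) ≈ F.point (φ k)
  class k = proj₂ (F.point-covers (f∈Q (E.point∈P k)))
  φ-injective : ∀ {k l} → φ k ≡ φ l → k ≡ l
  φ-injective {k} {l} eq = E.point-injective (f-injective (E.point∈P k) (E.point∈P l)
    (trans (class k) (≡.subst (λ m → F.point m ≈ f (E.point l)) (≡.sym eq) (sym (class l)))))
  k = proj₁ (injective⇒surjective φ φ-injective (proj₁ (F.point-covers qz)))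
  z≈fk : z ≈ f (E.point k)
  z≈fk = trans (proj₂ (F.point-covers qz))
    (≡.subst (λ m → F.point m ≈ f (E.point k)) (proj₂ (injective⇒surjective φ φ-injective _)) (sym (class k)))

module Arithmetic where
  open import Data.Nat.Base using (_+_; _*_; _^_)
  open import Data.Nat.Properties using (*-distribʳ-∸; *-comm; *-identityˡ; m+n∸n≡m; +-suc; +-identityʳ)
  open import Data.Nat.DivMod using (m*n/n≡m)
  open import Data.Nat.Tactic.RingSolver using (solve-∀)
  open import Relation.Binary.PropositionalEquality
  open ≡-Reasoning

  -- The number of points of the projective space of Kᵐ when |K| = q²: a point either has a unit first
  -- coordinate, normalised to 1, or a first coordinate in J (q choices) and a point of Kᵐ⁻¹ behind it.
  projectivePoints : ℕ → ℕ → ℕ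
  projectivePoints q zero    = 0
  projectivePoints q (suc m) = (q * q) ^ m + q * projectivePoints q m

  projectivePoints-closed : ∀ p k →
    projectivePoints (suc p) (suc k) * p + suc p ^ k ≡ suc p ^ k * suc p ^ suc k
  projectivePoints-closed p zero = base p
    where
    base : ∀ p → (1 + (1 + p) * 0) * p + 1 ≡ 1 * ((1 + p) * 1)
    base = solve-∀
  projectivePoints-closed p (suc k) = begin
    ((q * q) ^ suc k + q * P) * p + q * X  ≡⟨ regroup ((q * q) ^ suc k) q P p X ⟩
    (q * q) ^ suc k * p + q * (P * p + X)  ≡⟨ cong (λ t → (q * q) ^ suc k * p + q * t) (projectivePoints-closed p k) ⟩
    (q * q) ^ suc k * p + q * (X * (q * X)) ≡⟨ cong (λ t → q * q * t * p + q * (X * (q * X))) (^-square q k) ⟩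
    q * q * (X * X) * p + q * (X * (q * X)) ≡⟨ collect p X ⟩
    q * X * (q * (q * X))                   ∎
    where
    q = suc p
    X = q ^ k
    P = projectivePoints q (suc k)
    regroup : ∀ Y q P p X → (Y + q * P) * p + q * X ≡ Y * p + q * (P * p + X)
    regroup = solve-∀
    collect : ∀ p X → (1 + p) * (1 + p) * (X * X) * p + (1 + p) * (X * ((1 + p) * X)) ≡
                      (1 + p) * X * ((1 + p) * ((1 + p) * X))
    collect = solve-∀
    ^-square : ∀ q k → (q * q) ^ k ≡ q ^ k * q ^ k
    ^-square q zero    = refl
    ^-square q (suc k) = trans (cong (q * q *_) (^-square q k)) (interchange q (q ^ k))
      where
      interchange : ∀ a b → a * a * (b * b) ≡ a * b * (a * b)
      interchange = solve-∀

  commonCount≡projectivePoints : ∀ {q} → 2 ≤ q → ∀ e′ → commonCount q (2 + e′) ≡ projectivePoints q (e′ + (2 + e′))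
  commonCount≡projectivePoints {suc (suc p)} (s≤s (s≤s z≤n)) e′ = begin
    divℕ ((q ^ (2 * (2 + e′) ∸ 2) ∸ 1) * q ^ (2 * (2 + e′) ∸ 3)) (suc p)
      ≡⟨ cong (λ k → divℕ ((q ^ k ∸ 1) * q ^ (k ∸ 1)) (suc p)) exponent ⟩
    divℕ ((q ^ suc k ∸ 1) * q ^ k) (suc p)    ≡⟨ cong (λ n → divℕ n (suc p)) numerator ⟩
    divℕ (P * suc p) (suc p)                   ≡⟨ m*n/n≡m P (suc p) ⟩
    P                                          ≡⟨ cong (projectivePoints q) (sym (+-suc e′ (suc e′))) ⟩
    projectivePoints q (e′ + (2 + e′))         ∎
    where
    q = suc (suc p)
    k = e′ + suc e′
    P = projectivePoints q (suc k)
    exponent : 2 * (2 + e′) ∸ 2 ≡ suc k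
    exponent = trans (cong (λ t → e′ + suc (suc t)) (+-identityʳ e′)) (+-suc e′ (suc e′))
    numerator : (q ^ suc k ∸ 1) * q ^ k ≡ P * suc p
    numerator = begin
      (q ^ suc k ∸ 1) * q ^ k          ≡⟨ *-distribʳ-∸ (q ^ k) (q ^ suc k) 1 ⟩
      q ^ suc k * q ^ k ∸ 1 * q ^ k    ≡⟨ cong₂ _∸_ (*-comm (q ^ suc k) (q ^ k)) (*-identityˡ (q ^ k)) ⟩
      q ^ k * q ^ suc k ∸ q ^ k        ≡⟨ cong (_∸ q ^ k) (sym (projectivePoints-closed (suc p) k)) ⟩
      P * suc p + q ^ k ∸ q ^ k        ≡⟨ m+n∸n≡m _ (q ^ k) ⟩
      P * suc p                        ∎

open Arithmetic using (projectivePoints; commonCount≡projectivePoints)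

module RingLemmas {c ℓ} (K : CommutativeRing c ℓ) where
  open CommutativeRing K
  open Setup K
  open import Algebra.Properties.Ring ring using (-‿distribˡ-*; -‿distribʳ-*)
  open import Algebra.Properties.AbelianGroup +-abelianGroup using (⁻¹-involutive; inverseˡ-unique)
  open import Algebra.Properties.CommutativeSemigroup *-commutativeSemigroup using (interchange)
  open import Relation.Binary.Reasoning.Setoid setoid

  1-unit : IsUnit 1#
  1-unit = 1# , *-identityˡ 1#

  *-unit : ∀ {x y} → IsUnit x → IsUnit y → IsUnit (x * y)
  *-unit {x} {y} (x⁻¹ , xx⁻¹≈1) (y⁻¹ , yy⁻¹≈1) = x⁻¹ * y⁻¹ , (begin
    (x * y) * (x⁻¹ * y⁻¹)  ≈⟨ interchange x y x⁻¹ y⁻¹ ⟩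
    (x * x⁻¹) * (y * y⁻¹)  ≈⟨ *-cong xx⁻¹≈1 yy⁻¹≈1 ⟩
    1# * 1#                ≈⟨ *-identityˡ 1# ⟩
    1#                     ∎)

  inverse-unit : ∀ {x} (u : IsUnit x) → IsUnit (proj₁ u)
  inverse-unit {x} (x⁻¹ , xx⁻¹≈1) = x , trans (*-comm x⁻¹ x) xx⁻¹≈1

  unit-resp : ∀ {x y} → x ≈ y → IsUnit x → IsUnit y
  unit-resp x≈y (x⁻¹ , xx⁻¹≈1) = x⁻¹ , trans (*-congʳ (sym x≈y)) xx⁻¹≈1

  -‿unit : ∀ {x} → IsUnit x → IsUnit (- x)
  -‿unit {x} (x⁻¹ , xx⁻¹≈1) = - x⁻¹ , (begin
    - x * - x⁻¹    ≈⟨ -‿distribˡ-* x (- x⁻¹) ⟨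
    - (x * - x⁻¹)  ≈⟨ -‿cong (-‿distribʳ-* x x⁻¹) ⟨
    - - (x * x⁻¹)  ≈⟨ ⁻¹-involutive (x * x⁻¹) ⟩
    x * x⁻¹        ≈⟨ xx⁻¹≈1 ⟩
    1#             ∎)

  inverse-cancelˡ : ∀ {x} (u : IsUnit x) y → proj₁ u * (x * y) ≈ y
  inverse-cancelˡ {x} (x⁻¹ , xx⁻¹≈1) y = begin
    x⁻¹ * (x * y)  ≈⟨ *-assoc x⁻¹ x y ⟨
    (x⁻¹ * x) * y  ≈⟨ *-congʳ (trans (*-comm x⁻¹ x) xx⁻¹≈1) ⟩
    1# * y         ≈⟨ *-identityˡ y ⟩
    y              ∎

  solve-linear : ∀ {a x y} (u : IsUnit a) → a * x + y ≈ 0# → x ≈ - (proj₁ u * y)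
  solve-linear {a} {x} {y} u@(a⁻¹ , _) ax+y≈0 = begin
    x              ≈⟨ inverse-cancelˡ u x ⟨
    a⁻¹ * (a * x)  ≈⟨ *-congˡ (inverseˡ-unique (a * x) y ax+y≈0) ⟩
    a⁻¹ * - y      ≈⟨ -‿distribʳ-* a⁻¹ y ⟨
    - (a⁻¹ * y)    ∎

  principal-isIdeal : ∀ x → IsIdeal (Principal x)
  principal-isIdeal x = record
    { resp  = λ { y≈z (a , y≈ax) → a , trans (sym y≈z) y≈ax }
    ; zero∈ = 0# , sym (zeroˡ x)
    ; +∈    = λ { (a , y≈ax) (b , z≈bx) → a + b , trans (+-cong y≈ax z≈bx) (sym (distribʳ x a b)) }
    ; *∈    = λ { z (a , y≈ax) → z * a , trans (*-congˡ y≈ax) (sym (*-assoc z a x)) }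
    }

module LocalRing {c ℓ} (K : CommutativeRing c ℓ) (r : CommutativeRing.Carrier K)
                 (three-ideals : Setup.ThreeIdeals K r)
                 (q : ℕ) (residues : Setup.ResidueSize K r q) where
  open CommutativeRing K hiding (zero)
  open Setup K
  open RingLemmas K
  open import Algebra.Properties.Ring ring using (-1*x≈-x; [y-z]x≈yx-zx; x[y-z]≈xy-xz)
  open import Algebra.Properties.AbelianGroup +-abelianGroup
    using (⁻¹-anti-homo‿-; ⁻¹-∙-comm; ε⁻¹≈ε; //-rightDividesˡ; //-rightDividesʳ; x≈y⇒x∙y⁻¹≈ε; x∙y⁻¹≈ε⇒x≈y; xyx⁻¹≈y; ∙-cancelˡ)
  open import Algebra.Properties.CommutativeSemigroup *-commutativeSemigroup using (interchange; x∙yz≈y∙xz)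
  open import Relation.Binary.Reasoning.Setoid setoid

  J : Carrier → Set (c ⊔ ℓ)
  J = Principal r

  open IsIdeal (principal-isIdeal r) public
    renaming (resp to J-resp; zero∈ to 0∈J; +∈ to +∈J; *∈ to *∈J)

  r≉0 : ¬ r ≈ 0#
  r≉0 = proj₁ three-ideals

  1∉J : ¬ J 1#
  1∉J = proj₁ (proj₂ three-ideals)

  private
    ideals : ∀ I → IsIdeal I → _
    ideals = proj₂ (proj₂ three-ideals)
    rep = proj₁ residues

  r∈J : J r
  r∈J = 1# , sym (*-identityˡ r)

  *r∈J : ∀ x → J (x * r)
  *r∈J x = x , refl

  -‿∈J : ∀ {x} → J x → J (- x)
  -‿∈J {x} x∈J = J-resp (-1*x≈-x x) (*∈J (- 1#) x∈J)

  -∈J : ∀ {x y} → J x → J y → J (x - y)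
  -∈J x∈J y∈J = +∈J x∈J (-‿∈J y∈J)

  ∈J*ʳ : ∀ {x} z → J x → J (x * z)
  ∈J*ʳ {x} z x∈J = J-resp (*-comm z x) (*∈J z x∈J)

  unit⇒∉J : ∀ {x} → IsUnit x → ¬ J x
  unit⇒∉J (x⁻¹ , xx⁻¹≈1) x∈J = 1∉J (J-resp xx⁻¹≈1 (∈J*ʳ x⁻¹ x∈J))

  -- ⟨x⟩ contains x ∉ J, so of the three ideals it can only be K.
  ∉J⇒unit : ∀ {x} → ¬ J x → IsUnit x
  ∉J⇒unit {x} x∉J with ideals (Principal x) (principal-isIdeal x)
  ... | inj₁ ⟨x⟩≐0 = contradiction (J-resp (sym (lower (proj₁ (⟨x⟩≐0 x) x∈⟨x⟩))) 0∈J) x∉J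
    where x∈⟨x⟩ = 1# , sym (*-identityˡ x)
  ... | inj₂ (inj₁ ⟨x⟩≐J) = contradiction (proj₁ (⟨x⟩≐J x) (1# , sym (*-identityˡ x))) x∉J
  ... | inj₂ (inj₂ ⟨x⟩≐K) with y , 1≈yx ← proj₂ (⟨x⟩≐K 1#) (lift _) = y , trans (*-comm x y) (sym 1≈yx)

  infix 4 _≡J_ _≡J?_
  _≡J_ : Carrier → Carrier → Set (c ⊔ ℓ)
  x ≡J y = J (x - y)

  ≡J-setoid : Setoid c (c ⊔ ℓ)
  ≡J-setoid = record
    { Carrier       = Carrier
    ; _≈_           = _≡J_
    ; isEquivalence = record
      { refl  = λ {x} → J-resp (sym (-‿inverseʳ x)) 0∈J
      ; sym   = λ {x} {y} x≡y → J-resp (⁻¹-anti-homo‿- x y) (-‿∈J x≡y)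
      ; trans = λ {x} {y} {z} x≡y y≡z → J-resp (telescope x y z) (+∈J x≡y y≡z)
      }
    }
    where
    telescope : ∀ x y z → (x - y) + (y - z) ≈ x - z
    telescope x y z = begin
      (x - y) + (y - z)  ≈⟨ +-assoc (x - y) y (- z) ⟨
      ((x - y) + y) - z  ≈⟨ +-congʳ (//-rightDividesˡ y x) ⟩
      x - z              ∎

  residue-transversal : Transversal ≡J-setoid U (Fin q)
  residue-transversal = record
    { point           = rep
    ; point∈P         = _
    ; point-injective = proj₁ (proj₂ residues) _ _
    ; point-covers    = λ {x} _ → proj₂ (proj₂ residues) x
    }

  module ≡J = Setoid ≡J-setoid

  private
    module Residue = Transversal residue-transversal

  _≡J?_ : ∀ x y → Dec (x ≡J y)
  x ≡J? y with i , x≡i ← Residue.point-covers {x} _ | j , y≡j ← Residue.point-covers {y} _ | i ≟ j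
  ... | yes ≡.refl = yes (≡J.trans x≡i (≡J.sym y≡j))
  ... | no i≢j = no λ x≡y → i≢j (Residue.point-injective (≡J.trans (≡J.sym x≡i) (≡J.trans x≡y y≡j)))

  x-0≈x : ∀ x → x - 0# ≈ x
  x-0≈x x = trans (+-congˡ ε⁻¹≈ε) (+-identityʳ x)

  J? : ∀ x → Dec (J x)
  J? x = map′ (J-resp (x-0≈x x)) (J-resp (sym (x-0≈x x))) (x ≡J? 0#)

  unit⊎J : ∀ x → IsUnit x ⊎ J x
  unit⊎J x with J? x
  ... | yes x∈J = inj₂ x∈J
  ... | no x∉J  = inj₁ (∉J⇒unit x∉J)

  1+J-unit : ∀ {x} → J x → IsUnit (1# + x)
  1+J-unit {x} x∈J = ∉J⇒unit λ 1+x∈J → 1∉J (J-resp (//-rightDividesʳ x 1#) (-∈J 1+x∈J x∈J))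

  unit-annihilator : ∀ {x u} → IsUnit u → x * u ≈ 0# → x ≈ 0#
  unit-annihilator {x} {u} (u⁻¹ , uu⁻¹≈1) xu≈0 = begin
    x                ≈⟨ *-identityʳ x ⟨
    x * 1#           ≈⟨ *-congˡ uu⁻¹≈1 ⟨
    x * (u * u⁻¹)    ≈⟨ *-assoc x u u⁻¹ ⟨
    (x * u) * u⁻¹    ≈⟨ *-congʳ xu≈0 ⟩
    0# * u⁻¹         ≈⟨ zeroˡ u⁻¹ ⟩
    0#               ∎

  -- ⟨r²⟩ ⊆ J is {0} or J, and in the latter case r = y r², so the unit 1 - y r kills r.
  r*r≈0 : r * r ≈ 0#
  r*r≈0 with ideals (Principal (r * r)) (principal-isIdeal (r * r))
  ... | inj₁ ⟨r²⟩≐0 = lower (proj₁ (⟨r²⟩≐0 (r * r)) (1# , sym (*-identityˡ _)))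
  ... | inj₂ (inj₂ ⟨r²⟩≐K) with y , 1≈yr² ← proj₂ (⟨r²⟩≐K 1#) (lift _) =
    contradiction (y * r , trans 1≈yr² (sym (*-assoc y r r))) 1∉J
  ... | inj₂ (inj₁ ⟨r²⟩≐J) with y , r≈yr² ← proj₂ (⟨r²⟩≐J r) r∈J =
    contradiction (unit-annihilator (1+J-unit (-‿∈J (*r∈J y))) r[1-yr]≈0) r≉0
    where
    r[1-yr]≈0 : r * (1# - y * r) ≈ 0#
    r[1-yr]≈0 = begin
      r * (1# - y * r)        ≈⟨ x[y-z]≈xy-xz r 1# (y * r) ⟩
      r * 1# - r * (y * r)    ≈⟨ +-cong (*-identityʳ r) (-‿cong (x∙yz≈y∙xz r y r)) ⟩
      r - y * (r * r)         ≈⟨ +-congˡ (-‿cong r≈yr²) ⟨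
      r - r                   ≈⟨ -‿inverseʳ r ⟩
      0#                      ∎

  J*J≈0 : ∀ {x y} → J x → J y → x * y ≈ 0#
  J*J≈0 {x} {y} (a , x≈ar) (b , y≈br) = begin
    x * y              ≈⟨ *-cong x≈ar y≈br ⟩
    (a * r) * (b * r)  ≈⟨ interchange a r b r ⟩
    (a * b) * (r * r)  ≈⟨ *-congˡ r*r≈0 ⟩
    (a * b) * 0#       ≈⟨ zeroʳ (a * b) ⟩
    0#                 ∎

  *r≈0⇒J : ∀ {x} → x * r ≈ 0# → J x
  *r≈0⇒J {x} xr≈0 with unit⊎J x
  ... | inj₂ x∈J = x∈J
  ... | inj₁ x-unit = contradiction (unit-annihilator x-unit (trans (*-comm r x) xr≈0)) r≉0

  2≤q : 2 ≤ q
  2≤q with i₀ , 0≡i₀ ← Residue.point-covers {0#} _ | i₁ , 1≡i₁ ← Residue.point-covers {1#} _ =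
    distinct⇒2≤ i₀≢i₁
    where
    i₀≢i₁ : i₀ ≢ i₁
    i₀≢i₁ ≡.refl = 1∉J (J-resp (x-0≈x 1#) (≡J.trans 1≡i₁ (≡J.sym 0≡i₀)))
    distinct⇒2≤ : ∀ {n} {i j : Fin n} → i ≢ j → 2 ≤ n
    distinct⇒2≤ {suc zero}    {zero} {zero} i≢j = contradiction ≡.refl i≢j
    distinct⇒2≤ {suc (suc n)} _ = s≤s (s≤s z≤n)

  ≈⇒≡J : ∀ {x y} → x ≈ y → x ≡J y
  ≈⇒≡J x≈y = J-resp (sym (x≈y⇒x∙y⁻¹≈ε x≈y)) 0∈J

  ≡J-J : ∀ {x y} → x ≡J y → J y → J x
  ≡J-J {x} {y} x≡y y∈J = J-resp (//-rightDividesˡ y x) (+∈J x≡y y∈J)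

  -‿cong-≡J : ∀ {x y} → x ≡J y → - x ≡J - y
  -‿cong-≡J {x} {y} x≡y = J-resp (sym (⁻¹-∙-comm x (- y))) (-‿∈J x≡y)

  *-cong-≡J : ∀ z {x y} → x ≡J y → z * x ≡J z * y
  *-cong-≡J z {x} {y} x≡y = J-resp (x[y-z]≈xy-xz z x y) (*∈J z x≡y)

  +J≡J : ∀ x {y} → J y → x + y ≡J x
  +J≡J x {y} y∈J = J-resp (sym (xyx⁻¹≈y x y)) y∈J

  ≡J⇒*r≈ : ∀ {x y} → x ≡J y → x * r ≈ y * r
  ≡J⇒*r≈ {x} {y} x≡y = x∙y⁻¹≈ε⇒x≈y _ _ (trans (sym ([y-z]x≈yx-zx r x y)) (J*J≈0 x≡y r∈J))

  *r≈⇒≡J : ∀ {x y} → x * r ≈ y * r → x ≡J y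
  *r≈⇒≡J {x} {y} xr≈yr = *r≈0⇒J (trans ([y-z]x≈yx-zx r x y) (x≈y⇒x∙y⁻¹≈ε xr≈yr))

  J-transversal : Transversal setoid J (Fin q)
  J-transversal = record
    { point           = λ i → rep i * r
    ; point∈P         = λ i → *r∈J (rep i)
    ; point-injective = λ eq → Residue.point-injective (*r≈⇒≡J eq)
    ; point-covers    = λ { (y , x≈yr) → let i , y≡i = Residue.point-covers {y} _ in
                                          i , trans x≈yr (≡J⇒*r≈ y≡i) }
    }

  -- |K| = q²: every x is rep i + rep j * r for unique i and j.
  K-transversal : Transversal setoid U (Fin (q ℕ.* q))
  K-transversal = reindex *↔× record
    { point           = point
    ; point∈P         = _
    ; point-injective = injective
    ; point-covers    = covers
    }
    where
    module J-tr = Transversal J-transversal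
    point : Fin q × Fin q → Carrier
    point (i , j) = rep i + J-tr.point j
    injective : ∀ {k l} → point k ≈ point l → k ≡ l
    injective {i , j} {i′ , j′} eq with Residue.point-injective
      (≡J.trans (≡J.sym (+J≡J (rep i) (J-tr.point∈P j))) (≡J.trans (≈⇒≡J eq) (+J≡J (rep i′) (J-tr.point∈P j′))))
    ... | ≡.refl = ≡.cong (i ,_) (J-tr.point-injective (∙-cancelˡ (rep i) _ _ eq))
    covers : ∀ {x} → U x → ∃[ k ] x ≈ point k
    covers {x} _ with i , x≡i ← Residue.point-covers {x} _ with j , x-i≈j ← J-tr.point-covers x≡i =
      (i , j) , (begin
        x                        ≈⟨ //-rightDividesˡ (rep i) x ⟨
        (x - rep i) + rep i      ≈⟨ +-comm _ (rep i) ⟩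
        rep i + (x - rep i)      ≈⟨ +-congˡ x-i≈j ⟩
        rep i + J-tr.point j     ∎)

module ProjectiveSpace {c ℓ} (K : CommutativeRing c ℓ) where
  open CommutativeRing K
  open Setup K using (IsUnit)
  open RingLemmas K
  open import Relation.Binary.Reasoning.Setoid setoid

  Unimodular : {I : Set} → (I → Carrier) → Set (c ⊔ ℓ)
  Unimodular x = ∃[ k ] IsUnit (x k)

  infix 4 _∼_
  _∼_ : {I : Set} → (I → Carrier) → (I → Carrier) → Set (c ⊔ ℓ)
  x ∼ y = ∃[ λ′ ] IsUnit λ′ × (∀ k → y k ≈ λ′ * x k)

  ∼-setoid : Set → Setoid c (c ⊔ ℓ)
  ∼-setoid I = record
    { Carrier       = I → Carrier
    ; _≈_           = _∼_
    ; isEquivalence = record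
      { refl  = λ {x} → 1# , 1-unit , λ k → sym (*-identityˡ (x k))
      ; sym   = λ {x} (λ′ , λ′-unit , y≈λ′x) →
          proj₁ λ′-unit , inverse-unit λ′-unit ,
          λ k → sym (trans (*-congˡ (y≈λ′x k)) (inverse-cancelˡ λ′-unit (x k)))
      ; trans = λ {x} (λ′ , λ′-unit , y≈λ′x) (μ , μ-unit , z≈μy) →
          μ * λ′ , *-unit μ-unit λ′-unit ,
          λ k → trans (z≈μy k) (trans (*-congˡ (y≈λ′x k)) (sym (*-assoc μ λ′ (x k))))
      }
    }

  module ∼ {I : Set} = Setoid (∼-setoid I)

  ≈⇒∼ : ∀ {I : Set} {x y : I → Carrier} → (∀ k → x k ≈ y k) → x ∼ y
  ≈⇒∼ {x = x} x≈y = 1# , 1-unit , λ k → trans (sym (x≈y k)) (sym (*-identityˡ (x k)))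

  unimodular-resp : ∀ {I : Set} {x y : I → Carrier} → x ∼ y → Unimodular x → Unimodular y
  unimodular-resp (λ′ , λ′-unit , y≈λ′x) (k , xk-unit) = k , unit-resp (sym (y≈λ′x k)) (*-unit λ′-unit xk-unit)

  module _ {I J : Set} (I↔J : I ↔ J) where
    open Inverse I↔J

    unimodular-reindex : ∀ {y : J → Carrier} → Unimodular y → Unimodular (λ i → y (to i))
    unimodular-reindex {y} (j , yj-unit) = from j , unit-resp (reflexive (≡.cong y (≡.sym (strictlyInverseˡ j)))) yj-unit

    reindex-∼ : ∀ {p} {P : (I → Carrier) → Set p} {N : Set} →
      (∀ {x x′} → (∀ i → x i ≈ x′ i) → P x → P x′) →
      Transversal (∼-setoid I) P N → Transversal (∼-setoid J) (λ y → P (λ i → y (to i))) N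
    reindex-∼ {P = P} P-resp = transport record
      { map           = λ x j → x (from j)
      ; map∈Q         = λ {x} → P-resp λ i → reflexive (≡.cong x (≡.sym (strictlyInverseʳ i)))
      ; map-cong      = λ _ _ (λ′ , λ′-unit , x′≈λ′x) → λ′ , λ′-unit , λ j → x′≈λ′x (from j)
      ; map-injective = λ {x} {x′} _ _ (λ′ , λ′-unit , eq) → λ′ , λ′-unit , λ i →
          ≡.subst (λ k → x′ k ≈ λ′ * x k) (strictlyInverseʳ i) (eq (to i))
      ; map-onto      = λ {y} Py → (λ i → y (to i)) , Py ,
          ≈⇒∼ λ j → reflexive (≡.cong y (≡.sym (strictlyInverseˡ j)))
      }

  stabiliser-trivial : ∀ {I : Set} {x : I → Carrier} {λ′} → Unimodular x → (∀ k → x k ≈ λ′ * x k) → λ′ ≈ 1#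
  stabiliser-trivial {x = x} {λ′} (k , x⁻¹ , xx⁻¹≈1) x≈λ′x = begin
    λ′                ≈⟨ *-identityʳ λ′ ⟨
    λ′ * 1#           ≈⟨ *-congˡ xx⁻¹≈1 ⟨
    λ′ * (x k * x⁻¹)  ≈⟨ *-assoc λ′ (x k) x⁻¹ ⟨
    (λ′ * x k) * x⁻¹  ≈⟨ *-congʳ (x≈λ′x k) ⟨
    x k * x⁻¹         ≈⟨ xx⁻¹≈1 ⟩
    1#                ∎

module ProjectiveCount {c ℓ} (K : CommutativeRing c ℓ) (r : CommutativeRing.Carrier K)
                       (three-ideals : Setup.ThreeIdeals K r)
                       (q : ℕ) (residues : Setup.ResidueSize K r q) where
  open CommutativeRing K hiding (zero)
  open Setup K using (IsUnit)
  open RingLemmas K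
  open LocalRing K r three-ideals q residues
  open ProjectiveSpace K
  open import Relation.Binary.Reasoning.Setoid setoid

  normalised-transversal : ∀ m →
    Transversal (∼-setoid (Fin (suc m))) (λ x → IsUnit (head x)) (Fin ((q ℕ.* q) ℕ.^ m))
  normalised-transversal m = transport normalise (power K-transversal m)
    where
    normalise : ClassBijection (pointwise (Fin m) setoid) _ (∼-setoid (Fin (suc m))) (λ x → IsUnit (head x))
    normalise = record
      { map           = 1# ∷_
      ; map∈Q         = λ _ → 1-unit
      ; map-cong      = λ _ _ v≈w → ≈⇒∼ λ { zero → refl ; (suc k) → v≈w k }
      ; map-injective = λ _ _ (λ′ , _ , w≈λ′v) k →
          let λ′≈1 = trans (sym (*-identityʳ λ′)) (sym (w≈λ′v zero)) in
          sym (trans (w≈λ′v (suc k)) (trans (*-congʳ λ′≈1) (*-identityˡ _)))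
      ; map-onto      = λ {x} (x₀⁻¹ , x₀x₀⁻¹≈1) →
          (λ k → x₀⁻¹ * tail x k) , _ ,
          x₀⁻¹ , inverse-unit (x₀⁻¹ , x₀x₀⁻¹≈1) ,
          λ { zero → sym (trans (*-comm x₀⁻¹ (head x)) x₀x₀⁻¹≈1) ; (suc k) → refl }
      }

  J-headed-transversal : ∀ {m N} → Transversal (∼-setoid (Fin m)) Unimodular (Fin N) →
    Transversal (∼-setoid (Fin (suc m))) (λ x → J (head x) × Unimodular (tail x)) (Fin (q ℕ.* N))
  J-headed-transversal {m} {N} P = reindex *↔× record
    { point           = point
    ; point∈P         = λ (j , i) → J-tr.point∈P j , P.point∈P i
    ; point-injective = injective
    ; point-covers    = covers
    }
    where
    module J-tr = Transversal J-transversal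
    module P = Transversal P
    point : Fin q × Fin N → Fin (suc m) → Carrier
    point (j , i) = J-tr.point j ∷ P.point i
    injective : ∀ {k l} → point k ∼ point l → k ≡ l
    injective {j , i} {j′ , i′} (λ′ , λ′-unit , eq) with P.point-injective (λ′ , λ′-unit , λ k → eq (suc k))
    ... | ≡.refl = ≡.cong (_, i) (J-tr.point-injective (begin
      J-tr.point j         ≈⟨ *-identityˡ _ ⟨
      1# * J-tr.point j    ≈⟨ *-congʳ (stabiliser-trivial (P.point∈P i) (λ k → eq (suc k))) ⟨
      λ′ * J-tr.point j    ≈⟨ eq zero ⟨
      J-tr.point j′        ∎))
    covers : ∀ {x} → J (head x) × Unimodular (tail x) → ∃[ k ] x ∼ point k
    covers (x₀∈J , tail-unimodular)
      with i , λ′ , λ′-unit , eq ← P.point-covers tail-unimodular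
      with j , λ′x₀≈j ← J-tr.point-covers (*∈J λ′ x₀∈J) =
      (j , i) , λ′ , λ′-unit , λ { zero → sym λ′x₀≈j ; (suc k) → eq k }

  projective-transversal : ∀ m → Transversal (∼-setoid (Fin m)) Unimodular (Fin (projectivePoints q m))
  projective-transversal zero = record
    { point           = λ ()
    ; point∈P         = λ ()
    ; point-injective = λ { {()} }
    ; point-covers    = λ { (() , _) }
    }
  projective-transversal (suc m) =
    resp-≐ (merge , split)
      (reindex +↔⊎ (⊎-transversal disjoint (normalised-transversal m) (J-headed-transversal (projective-transversal m))))
    where
    disjoint : ∀ {x y : Fin (suc m) → Carrier} → IsUnit (head x) → J (head y) × Unimodular (tail y) → ¬ x ∼ y
    disjoint x₀-unit (y₀∈J , _) (λ′ , λ′-unit , y≈λ′x) =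
      unit⇒∉J (unit-resp (sym (y≈λ′x zero)) (*-unit λ′-unit x₀-unit)) y₀∈J
    merge : ∀ {x} → IsUnit (head x) ⊎ (J (head x) × Unimodular (tail x)) → Unimodular x
    merge (inj₁ x₀-unit)            = zero , x₀-unit
    merge (inj₂ (_ , k , xk-unit))  = suc k , xk-unit
    split : ∀ {x} → Unimodular x → IsUnit (head x) ⊎ (J (head x) × Unimodular (tail x))
    split {x} (k , xk-unit) with unit⊎J (head x) | k
    ... | inj₁ x₀-unit | _     = inj₁ x₀-unit
    ... | inj₂ x₀∈J    | zero  = contradiction x₀∈J (unit⇒∉J xk-unit)
    ... | inj₂ x₀∈J    | suc k = inj₂ (x₀∈J , k , xk-unit)

insertAt⁺ : ∀ {a b r} {A : Set a} {B : Set b} {R : A → B → Set r} {n} (p : Fin (suc n))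
            {y : Fin n → A} {y′ : Fin n → B} {v v′} →
            (∀ i → R (y i) (y′ i)) → R v v′ → ∀ k → R (insertAt y p v k) (insertAt y′ p v′ k)
insertAt⁺         zero    y~y′ v~v′ zero    = v~v′
insertAt⁺         zero    y~y′ v~v′ (suc k) = y~y′ k
insertAt⁺ {n = suc n} (suc p) y~y′ v~v′ zero    = y~y′ zero
insertAt⁺ {R = R} {n = suc n} (suc p) y~y′ v~v′ (suc k) = insertAt⁺ {R = R} p (λ i → y~y′ (suc i)) v~v′ k

insertAt-all : ∀ {a p} {A : Set a} {P : A → Set p} {n} (k : Fin (suc n)) {y : Fin n → A} {v} →
               (∀ i → P (y i)) → P v → ∀ j → P (insertAt y k v j)
insertAt-all {P = P} k {y} {v} = insertAt⁺ {R = λ _ → P} k {y = y} {v = v}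

module LinearForms {c ℓ} (K : CommutativeRing c ℓ) where
  open CommutativeRing K hiding (zero)
  open import Algebra.Properties.Semiring.Sum semiring using (sum; sum-cong-≋; sum-remove; ∑-distrib-+; *-distribˡ-sum)
  open import Algebra.Properties.Ring ring using (-1*x≈-x; [y-z]x≈yx-zx)
  open import Algebra.Properties.CommutativeSemigroup *-commutativeSemigroup using (x∙yz≈y∙xz)
  open import Relation.Binary.Reasoning.Setoid setoid

  sumF≡sum : ∀ {n} (f : Fin n → Carrier) → Setup.sumF K f ≡ sum f
  sumF≡sum {zero}  f = ≡.refl
  sumF≡sum {suc n} f = ≡.cong (f zero +_) (sumF≡sum (λ i → f (suc i)))

  dot : ∀ {n} → (Fin n → Carrier) → (Fin n → Carrier) → Carrier
  dot a x = sum (λ i → a i * x i)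

  dot-congʳ : ∀ {n} (a : Fin n → Carrier) {x y} → (∀ i → x i ≈ y i) → dot a x ≈ dot a y
  dot-congʳ a x≈y = sum-cong-≋ (λ i → *-congˡ (x≈y i))

  dot-scaleʳ : ∀ {n} (a : Fin n → Carrier) z x → dot a (λ i → z * x i) ≈ z * dot a x
  dot-scaleʳ a z x = begin
    sum (λ i → a i * (z * x i))  ≈⟨ sum-cong-≋ (λ i → x∙yz≈y∙xz (a i) z (x i)) ⟩
    sum (λ i → z * (a i * x i))  ≈⟨ *-distribˡ-sum z (λ i → a i * x i) ⟨
    z * dot a x                  ∎

  dot-removeAt : ∀ {n} (a x : Fin (suc n) → Carrier) p → dot a x ≈ a p * x p + dot (removeAt a p) (removeAt x p)
  dot-removeAt a x p = sum-remove {i = p} (λ i → a i * x i)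

  dot-scaleˡ : ∀ {n} z (a x : Fin n → Carrier) → dot (λ i → z * a i) x ≈ z * dot a x
  dot-scaleˡ z a x = begin
    sum (λ i → (z * a i) * x i)  ≈⟨ sum-cong-≋ (λ i → *-assoc z (a i) (x i)) ⟩
    sum (λ i → z * (a i * x i))  ≈⟨ *-distribˡ-sum z (λ i → a i * x i) ⟨
    z * dot a x                  ∎

  sum-neg : ∀ {n} (f : Fin n → Carrier) → sum (λ i → - f i) ≈ - sum f
  sum-neg f = begin
    sum (λ i → - f i)         ≈⟨ sum-cong-≋ (λ i → -1*x≈-x (f i)) ⟨
    sum (λ i → - 1# * f i)    ≈⟨ *-distribˡ-sum (- 1#) f ⟨
    - 1# * sum f              ≈⟨ -1*x≈-x (sum f) ⟩
    - sum f                   ∎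

  dot-subˡ : ∀ {n} (a b x : Fin n → Carrier) → dot (λ i → a i - b i) x ≈ dot a x - dot b x
  dot-subˡ a b x = begin
    sum (λ i → (a i - b i) * x i)            ≈⟨ sum-cong-≋ (λ i → [y-z]x≈yx-zx (x i) (a i) (b i)) ⟩
    sum (λ i → a i * x i - b i * x i)        ≈⟨ ∑-distrib-+ (λ i → a i * x i) (λ i → - (b i * x i)) ⟩
    dot a x + sum (λ i → - (b i * x i))      ≈⟨ +-congˡ (sum-neg (λ i → b i * x i)) ⟩
    dot a x - dot b x                        ∎

module Elimination {c ℓ} (K : CommutativeRing c ℓ) (r : CommutativeRing.Carrier K)
                   (three-ideals : Setup.ThreeIdeals K r)
                   (q : ℕ) (residues : Setup.ResidueSize K r q) where
  open CommutativeRing K hiding (zero)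
  open Setup K using (IsUnit)
  open RingLemmas K
  open LocalRing K r three-ideals q residues
  open ProjectiveSpace K
  open ProjectiveCount K r three-ideals q residues
  open LinearForms K
  open import Algebra.Properties.Ring ring using (-‿distribʳ-*)
  open import Algebra.Properties.AbelianGroup +-abelianGroup using (x≈y⇒x∙y⁻¹≈ε)
  open import Algebra.Properties.CommutativeSemigroup *-commutativeSemigroup using (x∙yz≈y∙xz)
  open import Relation.Binary.Reasoning.Setoid setoid

  unimodular⊎J : ∀ {n} (x : Fin n → Carrier) → Unimodular x ⊎ (∀ i → J (x i))
  unimodular⊎J {zero}  x = inj₂ λ ()
  unimodular⊎J {suc n} x with unit⊎J (x zero) | unimodular⊎J (λ i → x (suc i))
  ... | inj₁ x₀-unit | _                = inj₁ (zero , x₀-unit)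
  ... | inj₂ _       | inj₁ (i , xi-unit) = inj₁ (suc i , xi-unit)
  ... | inj₂ x₀∈J    | inj₂ tail∈J      = inj₂ λ { zero → x₀∈J ; (suc i) → tail∈J i }

  unimodular⇒¬J : ∀ {I : Set} {x : I → Carrier} → Unimodular x → ¬ (∀ i → J (x i))
  unimodular⇒¬J (i , xi-unit) x∈J = unit⇒∉J xi-unit (x∈J i)

  dot-J : ∀ {n} (a : Fin n → Carrier) {x} → (∀ i → J (x i)) → J (dot a x)
  dot-J {zero}  a x∈J = 0∈J
  dot-J {suc n} a x∈J = +∈J (*∈J (a zero) (x∈J zero)) (dot-J (λ i → a (suc i)) (λ i → x∈J (suc i)))

  all-J-removeAt : ∀ {n} (w : Fin (suc n) → Carrier) p → J (w p) → (∀ i → J (removeAt w p i)) → ∀ k → J (w k)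
  all-J-removeAt w p wp∈J rest∈J k =
    ≡.subst J (insertAt-removeAt w p k) (insertAt-all {P = J} p rest∈J wp∈J k)

  -- Gaussian elimination: the solutions of α · x = 0 are parametrised by their coordinates other than p.
  module Pivot {n} (α : Fin (suc n) → Carrier) (p : Fin (suc n)) (αp-unit : IsUnit (α p)) where
    private
      u = proj₁ αp-unit
      αu≈1 = proj₂ αp-unit

    -- The unique solution x of α · x = 0 with x ∘ punchIn p = y.
    extend : (Fin n → Carrier) → Fin (suc n) → Carrier
    extend y = insertAt y p (- (u * dot (removeAt α p) y))

    multiplier : (Fin (suc n) → Carrier) → Carrier
    multiplier β = β p * u

    reduced : (Fin (suc n) → Carrier) → Fin n → Carrier
    reduced β = removeAt (λ k → β k - multiplier β * α k) p

    extend-punchIn : ∀ y i → extend y (punchIn p i) ≈ y i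
    extend-punchIn y i = reflexive (insertAt-punchIn y p _ i)

    dot-extend-split : ∀ β y → dot β (extend y) ≈ β p * - (u * dot (removeAt α p) y) + dot (removeAt β p) y
    dot-extend-split β y = begin
      dot β (extend y)                                            ≈⟨ dot-removeAt β (extend y) p ⟩
      β p * extend y p + dot (removeAt β p) (removeAt (extend y) p) ≈⟨ +-cong (*-congˡ (reflexive (insertAt-lookup y p _)))
                                                                               (dot-congʳ (removeAt β p) (extend-punchIn y)) ⟩
      β p * - (u * dot (removeAt α p) y) + dot (removeAt β p) y   ∎

    dot-extend : ∀ β y → dot β (extend y) ≈ dot (reduced β) y
    dot-extend β y = begin
      dot β (extend y)                                 ≈⟨ dot-extend-split β y ⟩
      β p * - (u * D) + dot (removeAt β p) y          ≈⟨ +-comm _ _ ⟩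
      dot (removeAt β p) y + β p * - (u * D)          ≈⟨ +-congˡ (-‿distribʳ-* (β p) (u * D)) ⟨
      dot (removeAt β p) y - β p * (u * D)            ≈⟨ +-congˡ (-‿cong (*-assoc (β p) u D)) ⟨
      dot (removeAt β p) y - multiplier β * D         ≈⟨ +-congˡ (-‿cong (dot-scaleˡ (multiplier β) (removeAt α p) y)) ⟨
      dot (removeAt β p) y - dot (λ i → multiplier β * removeAt α p i) y
                                                      ≈⟨ dot-subˡ (removeAt β p) (λ i → multiplier β * removeAt α p i) y ⟨
      dot (reduced β) y                               ∎
      where D = dot (removeAt α p) y

    extend-solves : ∀ y → dot α (extend y) ≈ 0#
    extend-solves y = begin
      dot α (extend y)                         ≈⟨ dot-extend-split α y ⟩
      α p * - (u * D) + D                      ≈⟨ +-congʳ (-‿distribʳ-* (α p) (u * D)) ⟨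
      - (α p * (u * D)) + D                    ≈⟨ +-congʳ (-‿cong (*-assoc (α p) u D)) ⟨
      - ((α p * u) * D) + D                    ≈⟨ +-congʳ (-‿cong (trans (*-congʳ αu≈1) (*-identityˡ D))) ⟩
      - D + D                                  ≈⟨ -‿inverseˡ D ⟩
      0#                                       ∎
      where D = dot (removeAt α p) y

    extend-∼ : ∀ {y y′} → y ∼ y′ → extend y ∼ extend y′
    extend-∼ {y} {y′} (λ′ , λ′-unit , y′≈λ′y) =
      λ′ , λ′-unit , insertAt⁺ {R = λ a b → b ≈ λ′ * a} p y′≈λ′y (begin
        - (u * dot (removeAt α p) y′)          ≈⟨ -‿cong (*-congˡ (dot-congʳ (removeAt α p) y′≈λ′y)) ⟩
        - (u * dot (removeAt α p) (λ i → λ′ * y i)) ≈⟨ -‿cong (*-congˡ (dot-scaleʳ (removeAt α p) λ′ y)) ⟩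
        - (u * (λ′ * dot (removeAt α p) y))    ≈⟨ -‿cong (x∙yz≈y∙xz u λ′ _) ⟩
        - (λ′ * (u * dot (removeAt α p) y))    ≈⟨ -‿distribʳ-* λ′ _ ⟩
        λ′ * - (u * dot (removeAt α p) y)      ∎)

    extend-reflects-∼ : ∀ {y y′} → extend y ∼ extend y′ → y ∼ y′
    extend-reflects-∼ {y} {y′} (λ′ , λ′-unit , eq) = λ′ , λ′-unit , λ i → begin
      y′ i                     ≈⟨ extend-punchIn y′ i ⟨
      extend y′ (punchIn p i)  ≈⟨ eq (punchIn p i) ⟩
      λ′ * extend y (punchIn p i) ≈⟨ *-congˡ (extend-punchIn y i) ⟩
      λ′ * y i                 ∎

    solution≈extend : ∀ {x} → dot α x ≈ 0# → ∀ k → x k ≈ extend (removeAt x p) k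
    solution≈extend {x} αx≈0 k = begin
      x k                                           ≡⟨ insertAt-removeAt x p k ⟨
      insertAt (removeAt x p) p (x p) k             ≈⟨ insertAt⁺ {R = _≈_} p (λ _ → refl) pivot k ⟩
      extend (removeAt x p) k                       ∎
      where
      D = dot (removeAt α p) (removeAt x p)
      pivot : x p ≈ - (u * D)
      pivot = solve-linear αp-unit (trans (sym (dot-removeAt α x p)) αx≈0)

    extend-unimodular : ∀ {y} → Unimodular y → Unimodular (extend y)
    extend-unimodular (i , yi-unit) = punchIn p i , unit-resp (sym (extend-punchIn _ i)) yi-unit

    unimodular-extend⁻ : ∀ y → Unimodular (extend y) → Unimodular y
    unimodular-extend⁻ y extend-unimodular with unimodular⊎J y
    ... | inj₁ y-unimodular = y-unimodular
    ... | inj₂ y∈J = contradiction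
      (insertAt-all {P = J} p y∈J (-‿∈J (*∈J u (dot-J (removeAt α p) y∈J)))) (unimodular⇒¬J extend-unimodular)

    eliminate : ∀ {ℓq} {Q : (Fin (suc n) → Carrier) → Set ℓq} {I : Set} →
      (∀ {x x′} → (∀ k → x k ≈ x′ k) → Q x → Q x′) →
      Transversal (∼-setoid (Fin n)) (λ y → Unimodular y × Q (extend y)) I →
      Transversal (∼-setoid (Fin (suc n))) (λ x → Unimodular x × dot α x ≈ 0# × Q x) I
    eliminate Q-resp = transport record
      { map           = extend
      ; map∈Q         = λ {y} (y-unimodular , Q-extend) → extend-unimodular y-unimodular , extend-solves y , Q-extend
      ; map-cong      = λ _ _ → extend-∼
      ; map-injective = λ _ _ → extend-reflects-∼
      ; map-onto      = λ {x} (x-unimodular , αx≈0 , Qx) →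
          let x≈extend = solution≈extend αx≈0 in
          removeAt x p ,
          (unimodular-extend⁻ _ (unimodular-resp (≈⇒∼ x≈extend) x-unimodular) , Q-resp x≈extend Qx) ,
          ≈⇒∼ x≈extend
      }

    reduced-J⇒≡J : ∀ β → (∀ i → J (reduced β i)) → ∀ k → β k ≡J multiplier β * α k
    reduced-J⇒≡J β reduced∈J = all-J-removeAt (λ k → β k - multiplier β * α k) p (J-resp (sym pivot) 0∈J) reduced∈J
      where
      pivot : β p - multiplier β * α p ≈ 0#
      pivot = x≈y⇒x∙y⁻¹≈ε (begin
        β p                  ≈⟨ *-identityʳ (β p) ⟨
        β p * 1#             ≈⟨ *-congˡ (trans (*-comm u (α p)) αu≈1) ⟨
        β p * (u * α p)      ≈⟨ *-assoc (β p) u (α p) ⟨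
        multiplier β * α p   ∎)

  -- Unimodularity of reduced β says that α and β remain independent modulo J.
  common-zeros-transversal : ∀ {m} (α β : Fin (suc (suc m)) → Carrier) p (αp-unit : IsUnit (α p)) →
    Unimodular (Pivot.reduced α p αp-unit β) →
    Transversal (∼-setoid (Fin (suc (suc m)))) (λ x → Unimodular x × dot α x ≈ 0# × dot β x ≈ 0#)
                (Fin (projectivePoints q m))
  common-zeros-transversal {m} α β p αp-unit (s , γs-unit) =
    eliminate {Q = λ x → dot β x ≈ 0#} (λ x≈x′ βx≈0 → trans (sym (dot-congʳ β x≈x′)) βx≈0)
      (resp-≐ ((λ (y-unimodular , γy≈0 , _) → y-unimodular , trans (dot-extend β _) γy≈0) ,
               (λ (y-unimodular , βy≈0) → y-unimodular , trans (sym (dot-extend β _)) βy≈0 , _))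
        (Pivot.eliminate γ s γs-unit {Q = λ _ → ⊤ {ℓ = c ⊔ ℓ}} (λ _ _ → _)
          (resp-≐ ((λ y-unimodular → y-unimodular , _) , proj₁) (projective-transversal m))))
    where
    open Pivot α p αp-unit
    γ = reduced β

module Hyperplanes {c ℓ} (K : CommutativeRing c ℓ) (r : CommutativeRing.Carrier K)
                   (three-ideals : Setup.ThreeIdeals K r)
                   (q : ℕ) (residues : Setup.ResidueSize K r q) where
  open CommutativeRing K hiding (zero)
  open Setup K
  open RingLemmas K
  open LocalRing K r three-ideals q residues
  open LinearForms K
  open Elimination K r three-ideals q residues using (dot-J)
  open import Algebra.Properties.Ring ring using (-‿distribˡ-*)
  open import Algebra.Properties.AbelianGroup +-abelianGroup using (x≈y⇒x∙y⁻¹≈ε; xyx⁻¹≈y; //-rightDividesˡ)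
  open import Relation.Binary.Reasoning.Setoid setoid

  linComb≈dot : ∀ {e m} (z : Fin m → Carrier) (v : Fin m → Vect e) i → linComb z v i ≈ dot z (λ k → v k i)
  linComb≈dot z v i = reflexive (sumF≡sum (λ k → z k * v k i))

  r·ᵛ∈T : ∀ {e} (v : Vect e) → InT r (r ·ᵛ v)
  r·ᵛ∈T v s = J-resp (*-comm (v s) r) (*r∈J (v s))

  module Subspace {e d} {H : Vect e → Set (c ⊔ ℓ)} (H-subspace : IsSubspaceOfDim r e d H) where
    open IsSubspaceOfDim H-subspace

    linComb∈ : ∀ {m} (z : Fin m → Carrier) {v : Fin m → Vect e} → (∀ k → H (v k)) → H (linComb z v)
    linComb∈ {zero}  z v∈H = zero∈
    linComb∈ {suc m} z v∈H = +∈ (·∈ (z zero) (v∈H zero)) (linComb∈ (λ k → z (suc k)) (λ k → v∈H (suc k)))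

    -- w and a basis of H are d + 1 = 2e vectors of T independent over K/J; counting shows that they span T.
    complement : suc d ≡ e ℕ.+ e → ∀ {w} → InT r w → ¬ H w → ∀ {t} → InT r t → ∃[ ν ] H (t +ᵛ (ν ·ᵛ w))
    complement d+1≡2e {w} w∈T w∉H {t} t∈T =
      - z zero , resp (λ i → sym (t-z₀w≈rest i)) (linComb∈ (λ k → z (suc k)) basis∈)
      where
      B : Fin (suc d) → Vect e
      B = w ∷ basis

      B∈T : ∀ k → InT r (B k)
      B∈T zero    = w∈T
      B∈T (suc k) = ⊆T (basis∈ k)

      combination∈T : ∀ z → InT r (linComb z B)
      combination∈T z i = J-resp (sym (linComb≈dot z B i)) (dot-J z (λ k → B∈T k i))

      combination-injective : ∀ {z z′} → linComb z B ≈ᵛ linComb z′ B → ∀ k → z k ≡J z′ k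
      combination-injective {z} {z′} eq = λ { zero → δ₀∈J ; (suc k) → indep (λ k → δ (suc k)) rest≈0 k }
        where
        δ : Fin (suc d) → Carrier
        δ k = z k - z′ k
        L : Vect e
        L = linComb (λ k → δ (suc k)) basis
        δB≈0 : ∀ i → δ zero * w i + L i ≈ 0#
        δB≈0 i = begin
          δ zero * w i + L i              ≈⟨ +-congˡ (linComb≈dot (λ k → δ (suc k)) basis i) ⟩
          dot δ (λ k → B k i)             ≈⟨ dot-subˡ z z′ (λ k → B k i) ⟩
          dot z (λ k → B k i) - dot z′ (λ k → B k i)
            ≈⟨ x≈y⇒x∙y⁻¹≈ε (trans (sym (linComb≈dot z B i)) (trans (eq i) (linComb≈dot z′ B i))) ⟩
          0#                              ∎
        δ₀∈J : J (δ zero)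
        δ₀∈J with unit⊎J (δ zero)
        ... | inj₂ δ₀∈J   = δ₀∈J
        ... | inj₁ δ₀-unit = contradiction (resp (λ i → sym (w≈ i)) (·∈ _ (linComb∈ _ basis∈))) w∉H
          where
          w≈ : ∀ i → w i ≈ - proj₁ δ₀-unit * L i
          w≈ i = trans (solve-linear δ₀-unit (δB≈0 i)) (-‿distribˡ-* (proj₁ δ₀-unit) (L i))
        rest≈0 : L ≈ᵛ 0ᵛ
        rest≈0 i = begin
          L i                    ≈⟨ +-identityˡ (L i) ⟨
          0# + L i               ≈⟨ +-congʳ (J*J≈0 δ₀∈J (w∈T i)) ⟨
          δ zero * w i + L i     ≈⟨ δB≈0 i ⟩
          0#                     ∎

      T-transversal : Transversal (pointwise (Fin e ⊎ Fin e) setoid) (InT r) (Fin (q ℕ.^ suc d))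
      T-transversal = ≡.subst (λ n → Transversal (pointwise (Fin e ⊎ Fin e) setoid) (InT r) (Fin (q ℕ.^ n)))
                              (≡.sym d+1≡2e) (power-along +↔⊎ J-transversal)

      found = injective⇒onto (power residue-transversal (suc d)) T-transversal (λ z → linComb z B)
                (λ {z} _ → combination∈T z) (λ _ _ → combination-injective) t∈T
      z = proj₁ found

      t-z₀w≈rest : ∀ i → t i + - z zero * w i ≈ linComb (λ k → z (suc k)) basis i
      t-z₀w≈rest i = begin
        t i + - z zero * w i                  ≈⟨ +-cong (proj₂ (proj₂ found) i) (sym (-‿distribˡ-* (z zero) (w i))) ⟩
        z zero * w i + L - z zero * w i       ≈⟨ xyx⁻¹≈y (z zero * w i) L ⟩
        L                                     ∎
        where L = linComb (λ k → z (suc k)) basis i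

  hyperplane-complement : ∀ {e₀ H} → Hyperplane r (suc e₀) H →
    ∀ {w} → InT r w → ¬ H w → ∀ {t} → InT r t → ∃[ ν ] H (t +ᵛ (ν ·ᵛ w))
  hyperplane-complement H-hyperplane = Subspace.complement H-hyperplane ≡.refl

  -- t = μ (a + h) - b lies in T; correcting it along r b into H₂ gives h′ with b + h′ = (1 + ν r) μ (a + h).
  class-⊆ : ∀ {e} {H₁ H₂ : Vect e → Set (c ⊔ ℓ)} {a b : Vect e} {μ} →
    (∀ {h} → H₁ h → InT r h) → (∀ {t} → InT r t → ∃[ ν ] H₂ (t +ᵛ (ν ·ᵛ (r ·ᵛ b)))) →
    IsUnit μ → (∀ s → b s ≡J μ * a s) → ∀ {x} → InClass H₁ a x → InClass H₂ b x
  class-⊆ {e} {a = a} {b} {μ} H₁⊆T H₂-complement μ-unit b≡μa {x} (h , h∈H₁ , λ′ , λ′-unit , a+h≈λ′x) =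
    h′ , h′∈H₂ , ((1# + ν * r) * μ) * λ′ , *-unit (*-unit (1+J-unit (*r∈J ν)) μ-unit) λ′-unit , b+h′≈
    where
    t : Vect e
    t s = μ * (a s + h s) - b s
    t∈T : InT r t
    t∈T s = ≡J.trans (≈⇒≡J (distribˡ μ (a s) (h s))) (≡J.trans (+J≡J (μ * a s) (*∈J μ (H₁⊆T h∈H₁ s))) (≡J.sym (b≡μa s)))
    ν = proj₁ (H₂-complement t∈T)
    h′∈H₂ = proj₂ (H₂-complement t∈T)
    h′ = t +ᵛ (ν ·ᵛ (r ·ᵛ b))
    b+t≈μ[a+h] : ∀ s → b s + t s ≈ μ * (a s + h s)
    b+t≈μ[a+h] s = trans (+-comm (b s) (t s)) (//-rightDividesˡ (b s) (μ * (a s + h s)))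
    b+h′≈ : ∀ s → b s + h′ s ≈ (((1# + ν * r) * μ) * λ′) * x s
    b+h′≈ s = begin
      b s + (t s + ν * (r * b s))         ≈⟨ +-assoc (b s) (t s) _ ⟨
      (b s + t s) + ν * (r * b s)         ≈⟨ +-congˡ (*-congˡ (trans (sym (+-identityʳ _)) (+-congˡ (sym rt≈0)))) ⟩
      (b s + t s) + ν * (r * b s + r * t s) ≈⟨ +-congˡ (*-congˡ (distribˡ r (b s) (t s))) ⟨
      (b s + t s) + ν * (r * (b s + t s)) ≈⟨ +-cong (*-identityˡ _) (*-assoc ν r _) ⟨
      1# * (b s + t s) + (ν * r) * (b s + t s) ≈⟨ distribʳ (b s + t s) 1# (ν * r) ⟨
      (1# + ν * r) * (b s + t s)          ≈⟨ *-congˡ (b+t≈μ[a+h] s) ⟩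
      (1# + ν * r) * (μ * (a s + h s))    ≈⟨ *-congˡ (*-congˡ (a+h≈λ′x s)) ⟩
      (1# + ν * r) * (μ * (λ′ * x s))     ≈⟨ *-assoc (1# + ν * r) μ _ ⟨
      ((1# + ν * r) * μ) * (λ′ * x s)     ≈⟨ *-assoc _ λ′ (x s) ⟨
      (((1# + ν * r) * μ) * λ′) * x s     ∎
      where
      rt≈0 : r * t s ≈ 0#
      rt≈0 = J*J≈0 r∈J (t∈T s)

  congruent⇒same-class : ∀ {e₀ H₁ H₂} {a b : Vect (suc e₀)} {μ} →
    Hyperplane r (suc e₀) H₁ → Hyperplane r (suc e₀) H₂ → ¬ H₁ (r ·ᵛ a) → ¬ H₂ (r ·ᵛ b) →
    IsUnit μ → (∀ s → b s ≡J μ * a s) → ¬ DistinctClasses H₁ a H₂ b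
  congruent⇒same-class {a = a} {b} {μ} H₁-hyperplane H₂-hyperplane ra∉H₁ rb∉H₂ μ-unit b≡μa distinct =
    distinct λ _ _ →
      class-⊆ (IsSubspaceOfDim.⊆T H₁-hyperplane) (hyperplane-complement H₂-hyperplane (r·ᵛ∈T b) rb∉H₂) μ-unit b≡μa ,
      class-⊆ (IsSubspaceOfDim.⊆T H₂-hyperplane) (hyperplane-complement H₁-hyperplane (r·ᵛ∈T a) ra∉H₁)
              (inverse-unit μ-unit) a≡μ⁻¹b
    where
    a≡μ⁻¹b : ∀ s → a s ≡J proj₁ μ-unit * b s
    a≡μ⁻¹b s = ≡J.trans (≈⇒≡J (sym (inverse-cancelˡ μ-unit (a s)))) (≡J.sym (*-cong-≡J (proj₁ μ-unit) (b≡μa s)))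

module SymplecticForm {c ℓ} (K : CommutativeRing c ℓ) where
  open CommutativeRing K hiding (zero)
  open Setup K hiding (_∼_)
  open RingLemmas K
  open LinearForms K
  open ProjectiveSpace K
  open import Algebra.Properties.Semiring.Sum semiring using (sum; sum-cong-≋; ∑-distrib-+; sum-replicate-zero)
  open import Algebra.Properties.Ring ring using (-‿distribˡ-*)
  open import Algebra.Properties.AbelianGroup +-abelianGroup using (⁻¹-anti-homo‿-; ε⁻¹≈ε)
  open import Relation.Binary.Reasoning.Setoid setoid

  coefficients : ∀ {e} → Vect e → Vect e
  coefficients a (inj₁ i) = a (inj₂ i)
  coefficients a (inj₂ i) = - a (inj₁ i)

  flatten : ∀ {e} → Vect e → Fin (e ℕ.+ e) → Carrier
  flatten {e} x k = x (splitAt e k)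

  coefficients-unimodular : ∀ {e} {a : Vect e} → Unimodular a → Unimodular (coefficients a)
  coefficients-unimodular (inj₁ i , ai-unit) = inj₂ i , -‿unit ai-unit
  coefficients-unimodular (inj₂ i , ai-unit) = inj₁ i , ai-unit

  sum-splitAt : ∀ m {n} (f : Fin m ⊎ Fin n → Carrier) →
    sum (λ k → f (splitAt m k)) ≈ sum (λ i → f (inj₁ i)) + sum (λ j → f (inj₂ j))
  sum-splitAt zero    f = sym (+-identityˡ _)
  sum-splitAt (suc m) f = trans (+-congˡ (sum-splitAt m (λ s → f (Sum.map₁ suc s)))) (sym (+-assoc _ _ _))

  form≡sum : ∀ {e} (x a : Vect e) → form x a ≡ sum (λ i → x (inj₁ i) * a (inj₂ i) - x (inj₂ i) * a (inj₁ i))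
  form≡sum x a = sumF≡sum (λ i → x (inj₁ i) * a (inj₂ i) - x (inj₂ i) * a (inj₁ i))

  form≈dot : ∀ {e} (x a : Vect e) → form x a ≈ dot (flatten (coefficients a)) (flatten x)
  form≈dot {e} x a = begin
    form x a                                                   ≡⟨ form≡sum x a ⟩
    sum (λ i → x (inj₁ i) * a (inj₂ i) - x (inj₂ i) * a (inj₁ i))
      ≈⟨ ∑-distrib-+ (λ i → x (inj₁ i) * a (inj₂ i)) (λ i → - (x (inj₂ i) * a (inj₁ i))) ⟩
    sum (λ i → x (inj₁ i) * a (inj₂ i)) + sum (λ i → - (x (inj₂ i) * a (inj₁ i)))
      ≈⟨ +-cong (sum-cong-≋ λ i → *-comm (x (inj₁ i)) (a (inj₂ i)))
                (sum-cong-≋ λ i → trans (-‿cong (*-comm (x (inj₂ i)) (a (inj₁ i))))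
                                        (-‿distribˡ-* (a (inj₁ i)) (x (inj₂ i)))) ⟩
    sum (λ i → coefficients a (inj₁ i) * x (inj₁ i)) + sum (λ i → coefficients a (inj₂ i) * x (inj₂ i))
      ≈⟨ sum-splitAt e (λ s → coefficients a s * x s) ⟨
    dot (flatten (coefficients a)) (flatten x)                 ∎

  form-alternating : ∀ {e} (a : Vect e) → form a a ≈ 0#
  form-alternating {e} a = begin
    form a a                                                      ≡⟨ form≡sum a a ⟩
    sum (λ i → a (inj₁ i) * a (inj₂ i) - a (inj₂ i) * a (inj₁ i)) ≈⟨ sum-cong-≋ cancel ⟩
    sum {e} (λ _ → 0#)                                            ≈⟨ sum-replicate-zero e ⟩
    0#                                                            ∎
    where
    cancel : ∀ i → a (inj₁ i) * a (inj₂ i) - a (inj₂ i) * a (inj₁ i) ≈ 0#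
    cancel i = trans (+-congˡ (-‿cong (*-comm (a (inj₂ i)) (a (inj₁ i))))) (-‿inverseʳ _)

  form-antisymmetric : ∀ {e} (a b : Vect e) → form b a ≈ - form a b
  form-antisymmetric a b = begin
    form b a                                                        ≡⟨ form≡sum b a ⟩
    sum (λ i → b (inj₁ i) * a (inj₂ i) - b (inj₂ i) * a (inj₁ i))   ≈⟨ sum-cong-≋ swap ⟩
    sum (λ i → - t i)                                               ≈⟨ sum-neg t ⟩
    - sum t                                                         ≡⟨ ≡.cong -_ (form≡sum a b) ⟨
    - form a b                                                      ∎
    where
    t : Fin _ → Carrier
    t i = a (inj₁ i) * b (inj₂ i) - a (inj₂ i) * b (inj₁ i)
    swap : ∀ i → b (inj₁ i) * a (inj₂ i) - b (inj₂ i) * a (inj₁ i) ≈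
                 - (a (inj₁ i) * b (inj₂ i) - a (inj₂ i) * b (inj₁ i))
    swap i = trans (+-cong (*-comm (b (inj₁ i)) (a (inj₂ i))) (-‿cong (*-comm (b (inj₂ i)) (a (inj₁ i)))))
                   (sym (⁻¹-anti-homo‿- _ _))

  form-zero-resp-∼ : ∀ {e} {x y : Vect e} d → x ∼ y → form x d ≈ 0# → form y d ≈ 0#
  form-zero-resp-∼ {x = x} {y} d (λ′ , _ , y≈λ′x) xd≈0 = begin
    form y d                                          ≈⟨ form≈dot y d ⟩
    dot (flatten (coefficients d)) (flatten y)        ≈⟨ dot-congʳ _ (λ k → y≈λ′x (splitAt _ k)) ⟩
    dot (flatten (coefficients d)) (λ k → λ′ * flatten x k) ≈⟨ dot-scaleʳ _ λ′ (flatten x) ⟩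
    λ′ * dot (flatten (coefficients d)) (flatten x)   ≈⟨ *-congˡ (trans (sym (form≈dot x d)) xd≈0) ⟩
    λ′ * 0#                                           ≈⟨ zeroʳ λ′ ⟩
    0#                                                ∎

  form-zero-sym : ∀ {e} (a b : Vect e) → form a b ≈ 0# → form b a ≈ 0#
  form-zero-sym a b ab≈0 = trans (form-antisymmetric a b) (trans (-‿cong ab≈0) ε⁻¹≈ε)

module CommonNeighbours {c ℓ} (K : CommutativeRing c ℓ) (r : CommutativeRing.Carrier K)
  (three-ideals : Setup.ThreeIdeals K r) (q : ℕ) (residues : Setup.ResidueSize K r q)
  {e′ : ℕ} {H₁ H₂ : Setup.Vect K (2 ℕ.+ e′) → Set (c ⊔ ℓ)}
  (H₁-hyperplane : Setup.Hyperplane K r (2 ℕ.+ e′) H₁) (H₂-hyperplane : Setup.Hyperplane K r (2 ℕ.+ e′) H₂)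
  {a b : Setup.Vect K (2 ℕ.+ e′)} (a∈V′ : Setup.InV' K a) (b∈V′ : Setup.InV' K b)
  (ra∉H₁ : ¬ H₁ (Setup._·ᵛ_ K r a)) (rb∉H₂ : ¬ H₂ (Setup._·ᵛ_ K r b))
  (distinct : Setup.DistinctClasses K H₁ a H₂ b) where
  open CommutativeRing K hiding (zero)
  open Setup K hiding (_∼_)
  open RingLemmas K
  open LocalRing K r three-ideals q residues
  open ProjectiveSpace K
  open LinearForms K
  open Elimination K r three-ideals q residues
  open Hyperplanes K r three-ideals q residues
  open SymplecticForm K
  open import Algebra.Properties.Ring ring using (-‿distribʳ-*)
  open import Algebra.Properties.AbelianGroup +-abelianGroup using (⁻¹-involutive)

  e m : ℕ
  e = 2 ℕ.+ e′
  m = e′ ℕ.+ (2 ℕ.+ e′)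

  not-congruent : ∀ {μ} → IsUnit μ → ¬ (∀ s → b s ≡J μ * a s)
  not-congruent μ-unit b≡μa = congruent⇒same-class H₁-hyperplane H₂-hyperplane ra∉H₁ rb∉H₂ μ-unit b≡μa distinct

  a≁b : ¬ a ∼ b
  a≁b (λ′ , λ′-unit , b≈λ′a) = not-congruent λ′-unit (λ s → ≈⇒≡J (b≈λ′a s))

  α β : Fin (e ℕ.+ e) → Carrier
  α = flatten (coefficients a)
  β = flatten (coefficients b)

  p : Fin (e ℕ.+ e)
  p = proj₁ (unimodular-reindex +↔⊎ (coefficients-unimodular a∈V′))

  αp-unit : IsUnit (α p)
  αp-unit = proj₂ (unimodular-reindex +↔⊎ (coefficients-unimodular a∈V′))

  open Pivot α p αp-unit

  unflatten-≡J : ∀ {μ} → (∀ k → β k ≡J μ * α k) → ∀ s → b s ≡J μ * a s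
  unflatten-≡J {μ} β≡μα = λ { (inj₁ i) → negated (coefficient (inj₂ i)) ; (inj₂ i) → coefficient (inj₁ i) }
    where
    coefficient : ∀ j → coefficients b j ≡J μ * coefficients a j
    coefficient j = ≡.subst (λ j → coefficients b j ≡J μ * coefficients a j) (splitAt-join e e j) (β≡μα (join e e j))
    negated : ∀ {x y} → - x ≡J μ * - y → x ≡J μ * y
    negated {x} {y} -x≡μ[-y] = ≡J.trans (≈⇒≡J (sym (⁻¹-involutive x)))
      (≡J.trans (-‿cong-≡J -x≡μ[-y]) (≈⇒≡J (trans (-‿cong (sym (-‿distribʳ-* μ y))) (⁻¹-involutive (μ * y)))))

  reduced-unimodular : Unimodular (reduced β)
  reduced-unimodular with unimodular⊎J (reduced β)
  ... | inj₁ γ-unimodular = γ-unimodular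
  ... | inj₂ γ∈J = contradiction b≡μa (not-congruent μ-unit)
    where
    b≡μa = unflatten-≡J (reduced-J⇒≡J β γ∈J)
    μ-unit : IsUnit (multiplier β)
    μ-unit with unit⊎J (multiplier β)
    ... | inj₁ μ-unit = μ-unit
    ... | inj₂ μ∈J = contradiction (λ s → ≡J-J (b≡μa s) (∈J*ʳ (a s) μ∈J)) (unimodular⇒¬J b∈V′)

  ZeroSet : Vect e → Set (c ⊔ ℓ)
  ZeroSet x = InV' x × form x a ≈ 0# × form x b ≈ 0#

  zero-set-transversal : Transversal (∼-setoid (Fin e ⊎ Fin e)) ZeroSet (Fin (projectivePoints q m))
  zero-set-transversal =
    resp-≐ (flattened⊆ , ⊆flattened) (reindex-∼ +↔⊎ resp (common-zeros-transversal α β p αp-unit reduced-unimodular))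
    where
    resp : ∀ {x x′} → (∀ k → x k ≈ x′ k) → Unimodular x × dot α x ≈ 0# × dot β x ≈ 0# →
                                            Unimodular x′ × dot α x′ ≈ 0# × dot β x′ ≈ 0#
    resp x≈x′ (x-unimodular , αx≈0 , βx≈0) =
      unimodular-resp (≈⇒∼ x≈x′) x-unimodular ,
      trans (sym (dot-congʳ α x≈x′)) αx≈0 , trans (sym (dot-congʳ β x≈x′)) βx≈0
    flattened⊆ : ∀ {x} → Unimodular (flatten x) × dot α (flatten x) ≈ 0# × dot β (flatten x) ≈ 0# → ZeroSet x
    flattened⊆ {x} ((k , unit) , αx≈0 , βx≈0) =
      (splitAt e k , unit) , trans (form≈dot x a) αx≈0 , trans (form≈dot x b) βx≈0
    ⊆flattened : ∀ {x} → ZeroSet x → Unimodular (flatten x) × dot α (flatten x) ≈ 0# × dot β (flatten x) ≈ 0#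
    ⊆flattened {x} (x∈V′ , xa≈0 , xb≈0) =
      unimodular-reindex +↔⊎ x∈V′ , trans (sym (form≈dot x a)) xa≈0 , trans (sym (form≈dot x b)) xb≈0

  vertex-count : ∀ {P N} → Transversal (∼-setoid (Fin e ⊎ Fin e)) (λ x → InV' x × P x) (Fin N) → CountVertices P N
  vertex-count E = point , point∈P , (λ _ _ → point-injective) , λ _ x∈V′ Px → point-covers (x∈V′ , Px)
    where open Transversal E

  common-neighbours-nonadjacent : ¬ AdjComp a b → CountVertices (CommonNbr a b) (projectivePoints q m)
  common-neighbours-nonadjacent nonadjacent = vertex-count (resp-≐ (to , from) zero-set-transversal)
    where
    to : ∀ {x} → ZeroSet x → InV' x × CommonNbr a b x
    to {x} (x∈V′ , xa≈0 , xb≈0) = x∈V′ , (x≁a , lift xa≈0) , (x≁b , lift xb≈0)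
      where
      x≁a : ¬ x ∼ a
      x≁a x∼a = nonadjacent (a≁b , lift (form-zero-resp-∼ b x∼a xb≈0))
      x≁b : ¬ x ∼ b
      x≁b x∼b = nonadjacent (a≁b , lift (form-zero-sym b a (form-zero-resp-∼ a x∼b xa≈0)))
    from : ∀ {x} → InV' x × CommonNbr a b x → ZeroSet x
    from (x∈V′ , (_ , lift xa≈0) , (_ , lift xb≈0)) = x∈V′ , xa≈0 , xb≈0

  common-neighbours-adjacent : AdjComp a b → CountVertices (CommonNbr a b) (projectivePoints q m ∸ 2)
  common-neighbours-adjacent (_ , lift ab≈0) =
    vertex-count (resp-≐ (to , from) (remove₂ zero-set-transversal a∈ZeroSet b∈ZeroSet b≁a))
    where
    a∈ZeroSet : ZeroSet a
    a∈ZeroSet = a∈V′ , form-alternating a , ab≈0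
    b∈ZeroSet : ZeroSet b
    b∈ZeroSet = b∈V′ , form-zero-sym a b ab≈0 , form-alternating b
    b≁a : ¬ b ∼ a
    b≁a b∼a = a≁b (∼.sym b∼a)
    to : ∀ {x} → (ZeroSet x × ¬ x ∼ a) × ¬ x ∼ b → InV' x × CommonNbr a b x
    to (((x∈V′ , xa≈0 , xb≈0) , x≁a) , x≁b) = x∈V′ , (x≁a , lift xa≈0) , (x≁b , lift xb≈0)
    from : ∀ {x} → InV' x × CommonNbr a b x → (ZeroSet x × ¬ x ∼ a) × ¬ x ∼ b
    from (x∈V′ , (x≁a , lift xa≈0) , (x≁b , lift xb≈0)) = ((x∈V′ , xa≈0 , xb≈0) , x≁a) , x≁b

proposition3p11 : ∀ {c ℓ : Level} (K : CommutativeRing c ℓ) → let open Setup K in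
  (e : ℕ) → 2 ≤ e → FiniteRing →
  (r : Car) → ThreeIdeals r →
  (q : ℕ) → ResidueSize r q →
  (H₁ H₂ : Vect e → Set (c ⊔ ℓ)) → Hyperplane r e H₁ → Hyperplane r e H₂ →
  (a b : Vect e) → InV' a → InV' b →
  ¬ H₁ (r ·ᵛ a) → ¬ H₂ (r ·ᵛ b) →
  DistinctClasses H₁ a H₂ b →
  ((¬ AdjComp a b → CountVertices (CommonNbr a b) (commonCount q e)) ×
   (AdjComp a b → CountVertices (CommonNbr a b) (commonCount q e ∸ 2)))
proposition3p11 K (suc (suc e′)) (s≤s (s≤s z≤n)) _ r three-ideals q residues H₁ H₂ H₁-hyperplane H₂-hyperplane
                 a b a∈V′ b∈V′ ra∉H₁ rb∉H₂ distinct =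
  (λ nonadjacent → ≡.subst (CountVertices (CommonNbr a b)) (≡.sym count) (common-neighbours-nonadjacent nonadjacent)) ,
  (λ adjacent → ≡.subst (CountVertices (CommonNbr a b)) (≡.cong (_∸ 2) (≡.sym count)) (common-neighbours-adjacent adjacent))
  where
  open Setup K
  open CommonNeighbours K r three-ideals q residues H₁-hyperplane H₂-hyperplane a∈V′ b∈V′ ra∉H₁ rb∉H₂ distinct
  count : commonCount q (suc (suc e′)) ≡ projectivePoints q (e′ ℕ.+ suc (suc e′))
  count = commonCount≡projectivePoints (LocalRing.2≤q K r three-ideals q residues) e′
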